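{- Let $m$ be a positive integer. The number of $3$-tuples of points in $[m]^3$ that lie on a common plane with the origin is $O(m^6 \log m)$. Moreover, the number of coplanar $4$-tuples of points in $[m]^3$ is $O(m^9\log m)$. (The implicit constants are absolute.)
   Context: For a positive integer $m$, $[m]=\{0,1,\ldots,m-1\}$. A $4$-tuple of points is coplanar if all four points lie on a common (affine) plane in $\mathbb{R}^3$; a $3$-tuple is coplanar with the origin if the three points and the origin lie on a common plane. -}

module Defs where

open import Data.Nat using (ℕ; _≤_; _*_; _^_)
open import Data.Nat.Logarithm using (⌊log₂_⌋)
open import Data.Integer as ℤ using (ℤ; +_; 0ℤ)
open import Data.Fin using (Fin; toℕ)
open import Data.Product using (_×_; _,_; ∃-syntax)
open import Data.Vec using (Vec; _∷_; []; lookup)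
open import Data.List using (List; length)
open import Data.List.Relation.Unary.All using (All)
open import Data.List.Relation.Unary.Unique.Propositional using (Unique)
open import Relation.Nullary using (¬_)
open import Relation.Binary.PropositionalEquality using (_≡_)

Point : Set
Point = ℤ × ℤ × ℤ

-- A point of [m]³ = {0,…,m-1}³
Grid : ℕ → Set
Grid m = Fin m × Fin m × Fin m

embed : ∀ {m} → Grid m → Point
embed (x , y , z) = + toℕ x , + toℕ y , + toℕ z

origin : Point
origin = 0ℤ , 0ℤ , 0ℤ

record Plane : Set where
  constructor plane
  field
    a b c d : ℤ
    nondeg : ¬ (a ≡ 0ℤ × b ≡ 0ℤ × c ≡ 0ℤ)

OnPlane : Plane → Point → Set
OnPlane (plane a b c d _) (x , y , z) = a ℤ.* x ℤ.+ b ℤ.* y ℤ.+ c ℤ.* z ≡ d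

Coplanar4 : Point → Point → Point → Point → Set
Coplanar4 p q r s = ∃[ P ] (OnPlane P p × OnPlane P q × OnPlane P r × OnPlane P s)

CoplanarWithOrigin : ∀ {m} → Vec (Grid m) 3 → Set
CoplanarWithOrigin (p ∷ q ∷ r ∷ []) = Coplanar4 (embed p) (embed q) (embed r) origin

Coplanar : ∀ {m} → Vec (Grid m) 4 → Set
Coplanar (p ∷ q ∷ r ∷ s ∷ []) = Coplanar4 (embed p) (embed q) (embed r) (embed s)

-- "The number of elements of A satisfying P is at most N":
-- every duplicate-free list of elements satisfying P has length ≤ N.
CountAtMost : {A : Set} → (A → Set) → ℕ → Set
CountAtMost {A} P N = (xs : List A) → Unique xs → All P xs → length xs ≤ N

{-# OPTIONS --safe #-}
module Submission where

-- Every triple coplanar with the origin lies in a lattice plane n⊥, and n may be taken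
-- primitive (shortest among its multiples) with ‖ n ‖ ≤ 2 K², K the radius of the box.
-- Such a plane meets the box [-K, K]³ in at most 18 K² / ‖ n ‖ points: if a is a shortest
-- non-zero vector of the plane, a point p of the plane is determined by the integer k with
-- a ⨯ p = k n, where |k| ≤ 2 ‖ a ‖ K / ‖ n ‖, together with the block ⌊(pᵢ + K) / ‖ a ‖⌋ of a
-- coordinate where a is longest. Grouping the normals into dyadic shells 2 ^ j ≤ ‖ n ‖ < 2 ^ (j + 1),
-- a shell has O(8 ^ j) normals, each contributing at most (18 K² / 2 ^ j)³ triples, so each of the
-- O(log K) shells contributes O(K⁶) triples. Coplanar quadruples reduce to triples coplanar with
-- the origin by subtracting the first point, at the cost of a factor (2 K + 1)³.

open import Data.Empty using (⊥-elim)
open import Data.Fin using (Fin; toℕ)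
import Data.Fin.Properties as Fin
open import Data.Integer as ℤ using (ℤ; +_; -[1+_]; 0ℤ; 1ℤ; ∣_∣)
import Data.Integer.DivMod as ℤD
import Data.Integer.Properties as ℤP
open import Data.Integer.Tactic.RingSolver using (solve-∀)
open import Data.List using (List; []; _∷_; _++_; length; map; filter; cartesianProduct; concatMap; upTo)
open import Data.List.Extrema.Nat using (argmin; argmin-all; f[argmin]≤f[xs]; f[argmin]≤f[⊤])
open import Data.List.Membership.Propositional using (_∈_)
open import Data.List.Membership.Propositional.Properties
  using (∈-∃++; ∈-++⁻; ∈-++⁺ˡ; ∈-++⁺ʳ; ∈-cartesianProduct⁺; ∈-cartesianProduct⁻; ∈-filter⁺; ∈-filter⁻; ∈-map⁺; ∈-concatMap⁺; ∈-upTo⁺)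
import Data.List.Properties as LP
open import Data.List.Relation.Unary.All as All using (All; []; _∷_)
open import Data.List.Relation.Unary.All.Properties using (all-filter)
open import Data.List.Relation.Unary.AllPairs using ([]; _∷_)
open import Data.List.Relation.Unary.Any as Any using (here; there)
open import Data.List.Relation.Unary.Unique.Propositional using (Unique)
import Data.List.Relation.Unary.Unique.Propositional.Properties as Unique
open import Data.Nat as ℕ using (ℕ; zero; suc; z≤n; s≤s)
import Data.Nat.Properties as ℕP
open import Data.Nat.Tactic.RingSolver using () renaming (solve-∀ to ℕ-solve-∀)
open import Data.Product using (∃; ∃₂; ∃-syntax; _×_; _,_; proj₁; proj₂)
import Data.Product.Properties as Product
open import Data.Sum using (inj₁; inj₂)
open import Data.Vec using (Vec; []; _∷_)
open import Function using (_$_; _∘_)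
open import Relation.Binary.Definitions using (DecidableEquality)
open import Relation.Binary.PropositionalEquality
open import Relation.Nullary using (¬_; Dec; yes; no; ¬?; _×-dec_)
import Relation.Nullary.Decidable as Dec
open import Relation.Nullary.Decidable using (decidable-stable)
open import Relation.Unary using (Decidable)

open import Defs

module Counting where

  open import Data.Nat using (_+_; _*_; _^_; _≤_)

  private
    variable
      A B : Set

  InjectiveOn : (A → Set) → (A → B) → Set
  InjectiveOn P f = ∀ {x y} → P x → P y → f x ≡ f y → x ≡ y

  -- Remove f x from ys and recurse: the other elements of xs avoid it by injectivity.
  unique-length-≤ : {P : A → Set} {f : A → B} → InjectiveOn P f →
    ∀ {xs ys} → Unique xs → All P xs → All (λ x → f x ∈ ys) xs → length xs ≤ length ys
  unique-length-≤ f-inj {[]} _ _ _ = z≤n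
  unique-length-≤ {P = P} {f} f-inj {x ∷ xs} (x∉xs ∷ xs!) (Px ∷ Pxs) (fx∈ ∷ fxs∈) with ∈-∃++ fx∈
  ... | ys , zs , refl = begin
    suc (length xs)               ≤⟨ s≤s (unique-length-≤ f-inj xs! Pxs (avoid x∉xs Pxs fxs∈)) ⟩
    suc (length (ys ++ zs))       ≡⟨ cong suc (LP.length-++ ys) ⟩
    suc (length ys + length zs)   ≡⟨ ℕP.+-suc (length ys) (length zs) ⟨
    length ys + length (f x ∷ zs) ≡⟨ LP.length-++ ys ⟨
    length (ys ++ f x ∷ zs)       ∎
    where
    open ℕP.≤-Reasoning
    avoid : ∀ {ws} → All (x ≢_) ws → All P ws → All (λ w → f w ∈ ys ++ f x ∷ zs) ws → All (λ w → f w ∈ ys ++ zs) ws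
    avoid [] [] [] = []
    avoid (x≢w ∷ x≢ws) (Pw ∷ Pws) (fw∈ ∷ fws∈) with ∈-++⁻ ys fw∈
    ... | inj₁ fw∈ys = ∈-++⁺ˡ fw∈ys ∷ avoid x≢ws Pws fws∈
    ... | inj₂ (here fw≡fx) = ⊥-elim (x≢w (sym (f-inj Pw Px fw≡fx)))
    ... | inj₂ (there fw∈zs) = ∈-++⁺ʳ ys fw∈zs ∷ avoid x≢ws Pws fws∈

  countAtMost-injection : {P : A → Set} (f : A → B) (ys : List B) → InjectiveOn P f →
    (∀ {x} → P x → f x ∈ ys) → CountAtMost P (length ys)
  countAtMost-injection f ys f-inj f∈ xs xs! Pxs = unique-length-≤ f-inj xs! Pxs (All.map f∈ Pxs)

  countAtMost-mono : {P : A → Set} {M N : ℕ} → M ≤ N → CountAtMost P M → CountAtMost P N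
  countAtMost-mono M≤N count xs xs! Pxs = ℕP.≤-trans (count xs xs! Pxs) M≤N

  length-cartesianProduct : (xs : List A) (ys : List B) → length (cartesianProduct xs ys) ≡ length xs * length ys
  length-cartesianProduct [] ys = refl
  length-cartesianProduct (x ∷ xs) ys = begin
    length (map (x ,_) ys ++ cartesianProduct xs ys)       ≡⟨ LP.length-++ (map (x ,_) ys) ⟩
    length (map (x ,_) ys) + length (cartesianProduct xs ys) ≡⟨ cong₂ _+_ (LP.length-map (x ,_) ys) (length-cartesianProduct xs ys) ⟩
    length ys + length xs * length ys                       ∎
    where open ≡-Reasoning

  cube : List A → List (A × A × A)
  cube xs = cartesianProduct xs (cartesianProduct xs xs)

  ∈-cube⁺ : ∀ {xs : List A} {x y z} → x ∈ xs → y ∈ xs → z ∈ xs → (x , y , z) ∈ cube xs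
  ∈-cube⁺ x∈ y∈ z∈ = ∈-cartesianProduct⁺ x∈ (∈-cartesianProduct⁺ y∈ z∈)

  ∈-cube⁻ : ∀ {xs : List A} {x y z} → (x , y , z) ∈ cube xs → x ∈ xs × y ∈ xs × z ∈ xs
  ∈-cube⁻ {xs = xs} xyz∈ with ∈-cartesianProduct⁻ xs (cartesianProduct xs xs) xyz∈
  ... | x∈ , yz∈ = x∈ , ∈-cartesianProduct⁻ xs xs yz∈

  length-cube : (xs : List A) → length (cube xs) ≡ length xs ^ 3
  length-cube xs = begin
    length (cube xs)                                ≡⟨ length-cartesianProduct xs (cartesianProduct xs xs) ⟩
    length xs * length (cartesianProduct xs xs)     ≡⟨ cong (length xs *_) (length-cartesianProduct xs xs) ⟩
    length xs * (length xs * length xs)             ≡⟨ cong (λ l → length xs * (length xs * l)) (ℕP.*-identityʳ (length xs)) ⟨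
    length xs ^ 3                                   ∎
    where open ≡-Reasoning

  cube-unique : {xs : List A} → Unique xs → Unique (cube xs)
  cube-unique xs! = Unique.cartesianProduct⁺ xs! (Unique.cartesianProduct⁺ xs! xs!)

  length-concatMap-≤ : (f : A → List B) {M : ℕ} {xs : List A} →
    All (λ x → length (f x) ≤ M) xs → length (concatMap f xs) ≤ length xs * M
  length-concatMap-≤ f [] = z≤n
  length-concatMap-≤ f {M} {x ∷ xs} (fx≤M ∷ fxs≤M) = begin
    length (f x ++ concatMap f xs)               ≡⟨ LP.length-++ (f x) ⟩
    length (f x) + length (concatMap f xs)       ≤⟨ ℕP.+-mono-≤ fx≤M (length-concatMap-≤ f fxs≤M) ⟩
    M + length xs * M                            ∎
    where open ℕP.≤-Reasoning

  ∈-concatMap⁺′ : (f : A → List B) {xs : List A} {x : A} {y : B} → x ∈ xs → y ∈ f x → y ∈ concatMap f xs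
  ∈-concatMap⁺′ f x∈xs y∈fx = ∈-concatMap⁺ f (Any.map (λ { refl → y∈fx }) x∈xs)

module Arithmetic where

  open import Data.Nat using (_+_; _*_; _^_; _≤_; _<_; _/_; _%_; NonZero)
  import Data.Nat.DivMod as ℕD

  m*n≤o⇒m≤o/n : ∀ m n {o} .{{_ : NonZero n}} → m * n ≤ o → m ≤ o / n
  m*n≤o⇒m≤o/n m n m*n≤o = ℕP.≤-trans (ℕP.≤-reflexive (sym (ℕD.m*n/n≡m m n))) (ℕD./-monoˡ-≤ n m*n≤o)

  -- Equal quotients leave only the difference of the remainders.
  x/r≡y/r⇒∣x⊖y∣<r : ∀ x y r .{{_ : NonZero r}} → x / r ≡ y / r → ∣ x ℤ.⊖ y ∣ < r
  x/r≡y/r⇒∣x⊖y∣<r x y r x/r≡y/r = begin-strict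
    ∣ x ℤ.⊖ y ∣                                   ≡⟨ cong ∣_∣ (cong₂ ℤ._⊖_ (split x) (trans (split y) (cong (λ q → q * r + y % r) (sym x/r≡y/r)))) ⟩
    ∣ (x / r * r + x % r) ℤ.⊖ (x / r * r + y % r) ∣ ≡⟨ cong ∣_∣ (ℤP.+-cancelˡ-⊖ (x / r * r) (x % r) (y % r)) ⟩
    ∣ x % r ℤ.⊖ y % r ∣                           ≤⟨ ℤP.∣m⊝n∣≤m⊔n (x % r) (y % r) ⟩
    x % r ℕ.⊔ y % r                               <⟨ ℕP.⊔-lub (ℕD.m%n<n x r) (ℕD.m%n<n y r) ⟩
    r                                             ∎
    where
    open ℕP.≤-Reasoning
    split : ∀ z → z ≡ z / r * r + z % r
    split z = trans (ℕD.m≡m%n+[m/n]*n z r) (ℕP.+-comm (z % r) _)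

  ∣i∣≤K⇒+∣i+K∣≡i+K : ∀ {K} i → ∣ i ∣ ≤ K → + ∣ i ℤ.+ + K ∣ ≡ i ℤ.+ + K
  ∣i∣≤K⇒+∣i+K∣≡i+K (+ _)      _     = refl
  ∣i∣≤K⇒+∣i+K∣≡i+K -[1+ i ] 1+i≤K rewrite ℤP.⊖-≥ 1+i≤K = refl

  ∣i∣*r<r⇒i≡0 : ∀ i r → ∣ i ∣ * r < r → i ≡ 0ℤ
  ∣i∣*r<r⇒i≡0 i r ∣i∣*r<r with ∣ i ∣ in ∣i∣≡
  ... | zero  = ℤP.∣i∣≡0⇒i≡0 ∣i∣≡
  ... | suc t = ⊥-elim (ℕP.<⇒≱ ∣i∣*r<r (ℕP.m≤m+n r (t * r)))

  2^m<2^n⇒m<n : ∀ {m n} → 2 ^ m < 2 ^ n → m < n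
  2^m<2^n⇒m<n 2^m<2^n = ℕP.≰⇒> λ n≤m → ℕP.<⇒≱ 2^m<2^n (ℕP.^-monoʳ-≤ 2 n≤m)

  dyadic : ∀ {h} → 0 < h → ∃[ j ] 2 ^ j ≤ h × h < 2 ^ suc j
  dyadic {suc zero}    _ = 0 , ℕP.≤-refl , ℕP.n<1+n 1
  dyadic {suc (suc h)} _ with dyadic {suc h} (s≤s z≤n)
  ... | j , lo , hi with ℕP.m≤n⇒m<n∨m≡n hi
  ...   | inj₁ 2+h<2^[1+j] = j , ℕP.m≤n⇒m≤1+n lo , 2+h<2^[1+j]
  ...   | inj₂ 2+h≡2^[1+j] = suc j , ℕP.≤-reflexive (sym 2+h≡2^[1+j]) ,
    subst (_< 2 ^ suc (suc j)) (sym 2+h≡2^[1+j]) (ℕP.^-monoʳ-< 2 (ℕP.n<1+n 1) (ℕP.n<1+n (suc j)))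

  [1+2T]*[1+D]*h≤18K² : ∀ {K r h} T D → r ≤ K → h ≤ 2 * (r * K) → T * h ≤ 2 * (r * K) → D * r ≤ 2 * K →
    (1 + 2 * T) * (1 + D) * h ≤ 18 * (K * K)
  [1+2T]*[1+D]*h≤18K² {K} {r} {h} T D r≤K h≤ Th≤ Dr≤ = begin
    (1 + 2 * T) * (1 + D) * h                   ≡⟨ expand T D h ⟩
    h + D * h + 2 * (T * h) + 2 * (T * h * D)   ≤⟨ ℕP.+-mono-≤ (ℕP.+-mono-≤ (ℕP.+-mono-≤ h≤2K² Dh≤4K²) (ℕP.*-monoʳ-≤ 2 Th≤2K²)) (ℕP.*-monoʳ-≤ 2 ThD≤4K²) ⟩
    2 * (K * K) + 4 * (K * K) + 2 * (2 * (K * K)) + 2 * (4 * (K * K)) ≡⟨ collect (K * K) ⟩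
    18 * (K * K)                                ∎
    where
    open ℕP.≤-Reasoning
    expand : ∀ T D h → (1 + 2 * T) * (1 + D) * h ≡ h + D * h + 2 * (T * h) + 2 * (T * h * D)
    expand = ℕ-solve-∀
    collect : ∀ s → 2 * s + 4 * s + 2 * (2 * s) + 2 * (4 * s) ≡ 18 * s
    collect = ℕ-solve-∀
    2rK≤2K² : 2 * (r * K) ≤ 2 * (K * K)
    2rK≤2K² = ℕP.*-monoʳ-≤ 2 (ℕP.*-monoˡ-≤ K r≤K)
    h≤2K² : h ≤ 2 * (K * K)
    h≤2K² = ℕP.≤-trans h≤ 2rK≤2K²
    Th≤2K² : T * h ≤ 2 * (K * K)
    Th≤2K² = ℕP.≤-trans Th≤ 2rK≤2K²
    D2rK≤4K² : D * (2 * (r * K)) ≤ 4 * (K * K)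
    D2rK≤4K² = begin
      D * (2 * (r * K))   ≡⟨ regroup D r K ⟩
      (D * r) * (2 * K)   ≤⟨ ℕP.*-monoˡ-≤ (2 * K) Dr≤ ⟩
      2 * K * (2 * K)     ≡⟨ square K ⟩
      4 * (K * K)         ∎
      where
      regroup : ∀ D r K → D * (2 * (r * K)) ≡ (D * r) * (2 * K)
      regroup = ℕ-solve-∀
      square : ∀ K → 2 * K * (2 * K) ≡ 4 * (K * K)
      square = ℕ-solve-∀
    Dh≤4K² : D * h ≤ 4 * (K * K)
    Dh≤4K² = ℕP.≤-trans (ℕP.*-monoʳ-≤ D h≤) D2rK≤4K²
    ThD≤4K² : T * h * D ≤ 4 * (K * K)
    ThD≤4K² = ℕP.≤-trans (ℕP.≤-trans (ℕP.*-monoˡ-≤ D Th≤) (ℕP.≤-reflexive (ℕP.*-comm _ D))) D2rK≤4K²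

module Vectors where

  open import Data.Integer using (_+_; _*_; _-_)

  infixl 6 _-ᵥ_
  infixr 7 _·ᵥ_
  infixl 8 _⨯_
  infix 8 _∙_
  infix 4 _∥_ _⊥_ _≟ᵥ_ _⊥?_ _∥?_

  _-ᵥ_ : Point → Point → Point
  (x₁ , x₂ , x₃) -ᵥ (y₁ , y₂ , y₃) = x₁ - y₁ , x₂ - y₂ , x₃ - y₃

  _·ᵥ_ : ℤ → Point → Point
  k ·ᵥ (x₁ , x₂ , x₃) = k * x₁ , k * x₂ , k * x₃

  _∙_ : Point → Point → ℤ
  (x₁ , x₂ , x₃) ∙ (y₁ , y₂ , y₃) = x₁ * y₁ + x₂ * y₂ + x₃ * y₃

  _⨯_ : Point → Point → Point
  (x₁ , x₂ , x₃) ⨯ (y₁ , y₂ , y₃) = x₂ * y₃ - x₃ * y₂ , x₃ * y₁ - x₁ * y₃ , x₁ * y₂ - x₂ * y₁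

  -- Records rather than type synonyms, so that both points can be inferred from a proof.
  record _⊥_ (n x : Point) : Set where
    constructor orthogonal
    field ∙≡0 : n ∙ x ≡ 0ℤ

  record _∥_ (x y : Point) : Set where
    constructor parallel
    field ⨯≡origin : x ⨯ y ≡ origin

  open _⊥_ public
  open _∥_ public

  _≟ᵥ_ : DecidableEquality Point
  _≟ᵥ_ = Product.≡-dec ℤ._≟_ (Product.≡-dec ℤ._≟_ ℤ._≟_)

  _⊥?_ : ∀ n x → Dec (n ⊥ x)
  n ⊥? x = Dec.map′ orthogonal ∙≡0 (n ∙ x ℤ.≟ 0ℤ)

  _∥?_ : ∀ x y → Dec (x ∥ y)
  x ∥? y = Dec.map′ parallel ⨯≡origin (x ⨯ y ≟ᵥ origin)

  data Axis : Set where
    x-axis y-axis z-axis : Axis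

  coord : Axis → Point → ℤ
  coord x-axis (x , _ , _) = x
  coord y-axis (_ , y , _) = y
  coord z-axis (_ , _ , z) = z

  point-≡ : ∀ {x₁ x₂ x₃ y₁ y₂ y₃ : ℤ} → x₁ ≡ y₁ → x₂ ≡ y₂ → x₃ ≡ y₃ → (x₁ , x₂ , x₃) ≡ (y₁ , y₂ , y₃)
  point-≡ refl refl refl = refl

  coord-ext : ∀ {x y} → (∀ i → coord i x ≡ coord i y) → x ≡ y
  coord-ext {_ , _ , _} {_ , _ , _} h = point-≡ (h x-axis) (h y-axis) (h z-axis)

  coord-sub : ∀ i x y → coord i (x -ᵥ y) ≡ coord i x - coord i y
  coord-sub x-axis (_ , _ , _) (_ , _ , _) = refl
  coord-sub y-axis (_ , _ , _) (_ , _ , _) = refl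
  coord-sub z-axis (_ , _ , _) (_ , _ , _) = refl

  coord-scale : ∀ i k x → coord i (k ·ᵥ x) ≡ k * coord i x
  coord-scale x-axis k (_ , _ , _) = refl
  coord-scale y-axis k (_ , _ , _) = refl
  coord-scale z-axis k (_ , _ , _) = refl

  coord-origin : ∀ i → coord i origin ≡ 0ℤ
  coord-origin x-axis = refl
  coord-origin y-axis = refl
  coord-origin z-axis = refl

  -ᵥ-self : ∀ x → x -ᵥ x ≡ origin
  -ᵥ-self (x₁ , x₂ , x₃) = point-≡ (ℤP.+-inverseʳ x₁) (ℤP.+-inverseʳ x₂) (ℤP.+-inverseʳ x₃)

  -ᵥ≡origin⇒≡ : ∀ x y → x -ᵥ y ≡ origin → x ≡ y
  -ᵥ≡origin⇒≡ x y e = coord-ext λ i →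
    ℤP.i-j≡0⇒i≡j (coord i x) (coord i y) (trans (sym (coord-sub i x y)) (trans (cong (coord i) e) (coord-origin i)))

  -ᵥ-cancelʳ : ∀ x y z → x -ᵥ z ≡ y -ᵥ z → x ≡ y
  -ᵥ-cancelʳ x y z e = coord-ext λ i → begin
    coord i x                         ≡⟨ sub-add (coord i x) (coord i z) ⟨
    coord i x - coord i z + coord i z ≡⟨ cong (_+ coord i z) (trans (sym (coord-sub i x z)) (trans (cong (coord i) e) (coord-sub i y z))) ⟩
    coord i y - coord i z + coord i z ≡⟨ sub-add (coord i y) (coord i z) ⟩
    coord i y                         ∎
    where
    open ≡-Reasoning
    sub-add : ∀ a b → a - b + b ≡ a
    sub-add = solve-∀

  nonzero-coord : ∀ {x} → x ≢ origin → ∃[ i ] coord i x ≢ 0ℤ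
  nonzero-coord {x₁ , x₂ , x₃} x≢0 with x₁ ℤ.≟ 0ℤ | x₂ ℤ.≟ 0ℤ | x₃ ℤ.≟ 0ℤ
  ... | no x₁≢0 | _       | _       = x-axis , x₁≢0
  ... | yes _   | no x₂≢0 | _       = y-axis , x₂≢0
  ... | yes _   | yes _   | no x₃≢0 = z-axis , x₃≢0
  ... | yes refl | yes refl | yes refl = ⊥-elim (x≢0 refl)

  ∥⇒coord : ∀ {x y} → x ∥ y → ∀ i j → coord i x * coord j y ≡ coord j x * coord i y
  ∥⇒coord {x₁ , x₂ , x₃} {y₁ , y₂ , y₃} (parallel x⨯y≡0) = go
    where
    e₁ : x₂ * y₃ ≡ x₃ * y₂
    e₁ = ℤP.i-j≡0⇒i≡j _ _ (cong (coord x-axis) x⨯y≡0)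
    e₂ : x₃ * y₁ ≡ x₁ * y₃
    e₂ = ℤP.i-j≡0⇒i≡j _ _ (cong (coord y-axis) x⨯y≡0)
    e₃ : x₁ * y₂ ≡ x₂ * y₁
    e₃ = ℤP.i-j≡0⇒i≡j _ _ (cong (coord z-axis) x⨯y≡0)
    go : ∀ i j → coord i (x₁ , x₂ , x₃) * coord j (y₁ , y₂ , y₃) ≡ coord j (x₁ , x₂ , x₃) * coord i (y₁ , y₂ , y₃)
    go x-axis x-axis = refl
    go x-axis y-axis = e₃
    go x-axis z-axis = sym e₂
    go y-axis x-axis = sym e₃
    go y-axis y-axis = refl
    go y-axis z-axis = e₁
    go z-axis x-axis = e₂
    go z-axis y-axis = sym e₁
    go z-axis z-axis = refl

  coord⇒∥ : ∀ {x y} → (∀ i j → coord i x * coord j y ≡ coord j x * coord i y) → x ∥ y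
  coord⇒∥ {_ , _ , _} {_ , _ , _} h = parallel $
    point-≡ (ℤP.i≡j⇒i-j≡0 (h y-axis z-axis)) (ℤP.i≡j⇒i-j≡0 (h z-axis x-axis)) (ℤP.i≡j⇒i-j≡0 (h x-axis y-axis))

  ∥-refl : ∀ x → x ∥ x
  ∥-refl x = coord⇒∥ λ i j → ℤP.*-comm (coord i x) (coord j x)

  ∥-sym : ∀ {x y} → x ∥ y → y ∥ x
  ∥-sym {x} {y} x∥y = coord⇒∥ λ i j → begin
    coord i y * coord j x ≡⟨ ℤP.*-comm (coord i y) (coord j x) ⟩
    coord j x * coord i y ≡⟨ ∥⇒coord x∥y j i ⟩
    coord i x * coord j y ≡⟨ ℤP.*-comm (coord i x) (coord j y) ⟩
    coord j y * coord i x ∎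
    where open ≡-Reasoning

  origin-∥ : ∀ x → origin ∥ x
  origin-∥ (_ , _ , _) = parallel refl

  ∥-trans : ∀ {x y z} → y ≢ origin → x ∥ y → y ∥ z → x ∥ z
  ∥-trans {x} {y} {z} y≢0 x∥y y∥z = coord⇒∥ λ i j → ℤP.*-cancelˡ-≡ (yₗ * yₗ) _ _ {{ℤP.i*j≢0 yₗ yₗ}} (begin
    yₗ * yₗ * (coord i x * coord j z)                 ≡⟨ square-spread yₗ (coord i x) (coord j z) ⟩
    (coord i x * yₗ) * (yₗ * coord j z)               ≡⟨ cong₂ _*_ (∥⇒coord x∥y i l) (∥⇒coord y∥z l j) ⟩
    (coord l x * coord i y) * (coord j y * coord l z) ≡⟨ interchange (coord l x) (coord i y) (coord j y) (coord l z) ⟩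
    (coord l x * coord j y) * (coord i y * coord l z) ≡⟨ sym (cong₂ _*_ (∥⇒coord x∥y j l) (∥⇒coord y∥z l i)) ⟩
    (coord j x * yₗ) * (yₗ * coord i z)               ≡⟨ sym (square-spread yₗ (coord j x) (coord i z)) ⟩
    yₗ * yₗ * (coord j x * coord i z)                 ∎)
    where
    open ≡-Reasoning
    l = proj₁ (nonzero-coord y≢0)
    yₗ = coord l y
    instance
      yₗ-nonZero : ℤ.NonZero yₗ
      yₗ-nonZero = ℤ.≢-nonZero (proj₂ (nonzero-coord y≢0))
    square-spread : ∀ c a b → c * c * (a * b) ≡ (a * c) * (c * b)
    square-spread = solve-∀
    interchange : ∀ a b c d → (a * b) * (c * d) ≡ (a * c) * (b * d)
    interchange = solve-∀

  ∥-⊥ : ∀ {x y z} → y ≢ origin → y ∥ z → y ⊥ x → z ⊥ x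
  ∥-⊥ {x₁ , x₂ , x₃} {y@(y₁ , y₂ , y₃)} {z@(z₁ , z₂ , z₃)} y≢0 y∥z (orthogonal y∙x≡0) = orthogonal $
    ℤP.*-cancelˡ-≡ yₗ _ _ {{ℤ.≢-nonZero (proj₂ (nonzero-coord y≢0))}} (begin
      yₗ * (z₁ * x₁ + z₂ * x₂ + z₃ * x₃)                ≡⟨ distrib yₗ z₁ z₂ z₃ x₁ x₂ x₃ ⟩
      yₗ * z₁ * x₁ + yₗ * z₂ * x₂ + yₗ * z₃ * x₃       ≡⟨ cong₂ _+_ (cong₂ _+_ (swap x-axis x₁) (swap y-axis x₂)) (swap z-axis x₃) ⟩
      y₁ * zₗ * x₁ + y₂ * zₗ * x₂ + y₃ * zₗ * x₃       ≡⟨ collect zₗ y₁ y₂ y₃ x₁ x₂ x₃ ⟩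
      zₗ * (y₁ * x₁ + y₂ * x₂ + y₃ * x₃)                ≡⟨ cong (zₗ *_) y∙x≡0 ⟩
      zₗ * 0ℤ                                           ≡⟨ ℤP.*-zeroʳ zₗ ⟩
      0ℤ                                                ≡⟨ ℤP.*-zeroʳ yₗ ⟨
      yₗ * 0ℤ                                           ∎)
    where
    open ≡-Reasoning
    l = proj₁ (nonzero-coord y≢0)
    yₗ = coord l y
    zₗ = coord l z
    swap : ∀ i w → yₗ * coord i z * w ≡ coord i y * zₗ * w
    swap i w = cong (_* w) (∥⇒coord y∥z l i)
    distrib : ∀ c a₁ a₂ a₃ b₁ b₂ b₃ → c * (a₁ * b₁ + a₂ * b₂ + a₃ * b₃) ≡ c * a₁ * b₁ + c * a₂ * b₂ + c * a₃ * b₃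
    distrib = solve-∀
    collect : ∀ c a₁ a₂ a₃ b₁ b₂ b₃ → a₁ * c * b₁ + a₂ * c * b₂ + a₃ * c * b₃ ≡ c * (a₁ * b₁ + a₂ * b₂ + a₃ * b₃)
    collect = solve-∀

  ⊥-sym : ∀ {x y} → x ⊥ y → y ⊥ x
  ⊥-sym {x₁ , x₂ , x₃} {y₁ , y₂ , y₃} (orthogonal x∙y≡0) = orthogonal (trans (comm x₁ x₂ x₃ y₁ y₂ y₃) x∙y≡0)
    where
    comm : ∀ y₁ y₂ y₃ x₁ x₂ x₃ → x₁ * y₁ + x₂ * y₂ + x₃ * y₃ ≡ y₁ * x₁ + y₂ * x₂ + y₃ * x₃
    comm = solve-∀

  ⨯-⊥ˡ : ∀ x y → x ⨯ y ⊥ x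
  ⨯-⊥ˡ (x₁ , x₂ , x₃) (y₁ , y₂ , y₃) = orthogonal (triple x₁ x₂ x₃ y₁ y₂ y₃)
    where
    triple : ∀ x₁ x₂ x₃ y₁ y₂ y₃ → (x₂ * y₃ - x₃ * y₂) * x₁ + (x₃ * y₁ - x₁ * y₃) * x₂ + (x₁ * y₂ - x₂ * y₁) * x₃ ≡ 0ℤ
    triple = solve-∀

  ⨯-⊥ʳ : ∀ x y → x ⨯ y ⊥ y
  ⨯-⊥ʳ (x₁ , x₂ , x₃) (y₁ , y₂ , y₃) = orthogonal (triple x₁ x₂ x₃ y₁ y₂ y₃)
    where
    triple : ∀ x₁ x₂ x₃ y₁ y₂ y₃ → (x₂ * y₃ - x₃ * y₂) * y₁ + (x₃ * y₁ - x₁ * y₃) * y₂ + (x₁ * y₂ - x₂ * y₁) * y₃ ≡ 0ℤ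
    triple = solve-∀

  ∙-origin : ∀ n → n ∙ origin ≡ 0ℤ
  ∙-origin (n₁ , n₂ , n₃) = vanish n₁ n₂ n₃
    where
    vanish : ∀ n₁ n₂ n₃ → n₁ * 0ℤ + n₂ * 0ℤ + n₃ * 0ℤ ≡ 0ℤ
    vanish = solve-∀

  ∙-sub : ∀ n x y → n ∙ (x -ᵥ y) ≡ n ∙ x - n ∙ y
  ∙-sub (n₁ , n₂ , n₃) (x₁ , x₂ , x₃) (y₁ , y₂ , y₃) = expand n₁ n₂ n₃ x₁ x₂ x₃ y₁ y₂ y₃
    where
    expand : ∀ n₁ n₂ n₃ x₁ x₂ x₃ y₁ y₂ y₃ →
      n₁ * (x₁ - y₁) + n₂ * (x₂ - y₂) + n₃ * (x₃ - y₃) ≡ (n₁ * x₁ + n₂ * x₂ + n₃ * x₃) - (n₁ * y₁ + n₂ * y₂ + n₃ * y₃)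
    expand = solve-∀

  ∙-sub-scaled : ∀ n x k y → n ∙ (x -ᵥ k ·ᵥ y) ≡ n ∙ x - k * n ∙ y
  ∙-sub-scaled (n₁ , n₂ , n₃) (x₁ , x₂ , x₃) k (y₁ , y₂ , y₃) = expand n₁ n₂ n₃ x₁ x₂ x₃ k y₁ y₂ y₃
    where
    expand : ∀ n₁ n₂ n₃ x₁ x₂ x₃ k y₁ y₂ y₃ →
      n₁ * (x₁ - k * y₁) + n₂ * (x₂ - k * y₂) + n₃ * (x₃ - k * y₃) ≡ (n₁ * x₁ + n₂ * x₂ + n₃ * x₃) - k * (n₁ * y₁ + n₂ * y₂ + n₃ * y₃)
    expand = solve-∀

  ⊥-sub : ∀ {n x y} → n ⊥ x → n ⊥ y → n ⊥ x -ᵥ y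
  ⊥-sub {n} {x} {y} (orthogonal n∙x≡0) (orthogonal n∙y≡0) = orthogonal (trans (∙-sub n x y) (cong₂ _-_ n∙x≡0 n∙y≡0))

  0·ᵥ≡origin : ∀ x → 0ℤ ·ᵥ x ≡ origin
  0·ᵥ≡origin (_ , _ , _) = refl

  ⊥-sub-scaled : ∀ {n x y} k → n ⊥ x → n ⊥ y → n ⊥ x -ᵥ k ·ᵥ y
  ⊥-sub-scaled {n} {x} {y} k (orthogonal n∙x≡0) (orthogonal n∙y≡0) = orthogonal $ begin
    n ∙ (x -ᵥ k ·ᵥ y)  ≡⟨ ∙-sub-scaled n x k y ⟩
    n ∙ x - k * n ∙ y  ≡⟨ cong₂ (λ a b → a - k * b) n∙x≡0 n∙y≡0 ⟩
    0ℤ - k * 0ℤ        ≡⟨ cong (0ℤ -_) (ℤP.*-zeroʳ k) ⟩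
    0ℤ                 ∎
    where open ≡-Reasoning

  ∥-sub-scaled : ∀ {x y z} k → x ∥ z → y ∥ z → x -ᵥ k ·ᵥ y ∥ z
  ∥-sub-scaled {x₁ , x₂ , x₃} {y₁ , y₂ , y₃} {z₁ , z₂ , z₃} k (parallel x⨯z≡0) (parallel y⨯z≡0) = parallel $ begin
    ((x₁ , x₂ , x₃) -ᵥ k ·ᵥ (y₁ , y₂ , y₃)) ⨯ (z₁ , z₂ , z₃)
      ≡⟨ point-≡ (linear k x₂ x₃ y₂ y₃ z₂ z₃) (linear k x₃ x₁ y₃ y₁ z₃ z₁) (linear k x₁ x₂ y₁ y₂ z₁ z₂) ⟩
    (x₁ , x₂ , x₃) ⨯ (z₁ , z₂ , z₃) -ᵥ k ·ᵥ ((y₁ , y₂ , y₃) ⨯ (z₁ , z₂ , z₃))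
      ≡⟨ cong₂ (λ u v → u -ᵥ k ·ᵥ v) x⨯z≡0 y⨯z≡0 ⟩
    origin -ᵥ k ·ᵥ origin
      ≡⟨ cong (λ c → origin -ᵥ (c , c , c)) (ℤP.*-zeroʳ k) ⟩
    origin ∎
    where
    open ≡-Reasoning
    linear : ∀ k x₂ x₃ y₂ y₃ z₂ z₃ → (x₂ - k * y₂) * z₃ - (x₃ - k * y₃) * z₂ ≡ (x₂ * z₃ - x₃ * z₂) - k * (y₂ * z₃ - y₃ * z₂)
    linear = solve-∀

  ⨯-cancelˡ : ∀ a x y → a ⨯ x ≡ a ⨯ y → x -ᵥ y ∥ a
  ⨯-cancelˡ (a₁ , a₂ , a₃) (x₁ , x₂ , x₃) (y₁ , y₂ , y₃) a⨯x≡a⨯y = parallel $ begin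
    ((x₁ , x₂ , x₃) -ᵥ (y₁ , y₂ , y₃)) ⨯ (a₁ , a₂ , a₃)
      ≡⟨ point-≡ (expand a₂ a₃ x₂ x₃ y₂ y₃) (expand a₃ a₁ x₃ x₁ y₃ y₁) (expand a₁ a₂ x₁ x₂ y₁ y₂) ⟩
    (a₁ , a₂ , a₃) ⨯ (y₁ , y₂ , y₃) -ᵥ (a₁ , a₂ , a₃) ⨯ (x₁ , x₂ , x₃)
      ≡⟨ cong (_-ᵥ (a₁ , a₂ , a₃) ⨯ (x₁ , x₂ , x₃)) (sym a⨯x≡a⨯y) ⟩
    (a₁ , a₂ , a₃) ⨯ (x₁ , x₂ , x₃) -ᵥ (a₁ , a₂ , a₃) ⨯ (x₁ , x₂ , x₃)
      ≡⟨ -ᵥ-self ((a₁ , a₂ , a₃) ⨯ (x₁ , x₂ , x₃)) ⟩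
    origin ∎
    where
    open ≡-Reasoning
    expand : ∀ a₂ a₃ x₂ x₃ y₂ y₃ → (x₂ - y₂) * a₃ - (x₃ - y₃) * a₂ ≡ (a₂ * y₃ - a₃ * y₂) - (a₂ * x₃ - a₃ * x₂)
    expand = solve-∀

  -- The vector triple product expansion (a ⨯ p) ⨯ n = (n ∙ a) p - (n ∙ p) a.
  ⊥⊥⇒⨯∥ : ∀ {n a p} → n ⊥ a → n ⊥ p → a ⨯ p ∥ n
  ⊥⊥⇒⨯∥ {n₁ , n₂ , n₃} {a₁ , a₂ , a₃} {p₁ , p₂ , p₃} (orthogonal n∙a≡0) (orthogonal n∙p≡0) = parallel $
    point-≡ (trans (expand₁ a₁ a₂ a₃ p₁ p₂ p₃ n₁ n₂ n₃) (vanish p₁ a₁))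
            (trans (expand₂ a₁ a₂ a₃ p₁ p₂ p₃ n₁ n₂ n₃) (vanish p₂ a₂))
            (trans (expand₃ a₁ a₂ a₃ p₁ p₂ p₃ n₁ n₂ n₃) (vanish p₃ a₃))
    where
    vanish : ∀ pᵢ aᵢ → (n₁ * a₁ + n₂ * a₂ + n₃ * a₃) * pᵢ - (n₁ * p₁ + n₂ * p₂ + n₃ * p₃) * aᵢ ≡ 0ℤ
    vanish pᵢ aᵢ = cong₂ (λ s t → s * pᵢ - t * aᵢ) n∙a≡0 n∙p≡0
    expand₁ : ∀ a₁ a₂ a₃ p₁ p₂ p₃ n₁ n₂ n₃ → (a₃ * p₁ - a₁ * p₃) * n₃ - (a₁ * p₂ - a₂ * p₁) * n₂
      ≡ (n₁ * a₁ + n₂ * a₂ + n₃ * a₃) * p₁ - (n₁ * p₁ + n₂ * p₂ + n₃ * p₃) * a₁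
    expand₁ = solve-∀
    expand₂ : ∀ a₁ a₂ a₃ p₁ p₂ p₃ n₁ n₂ n₃ → (a₁ * p₂ - a₂ * p₁) * n₁ - (a₂ * p₃ - a₃ * p₂) * n₃
      ≡ (n₁ * a₁ + n₂ * a₂ + n₃ * a₃) * p₂ - (n₁ * p₁ + n₂ * p₂ + n₃ * p₃) * a₂
    expand₂ = solve-∀
    expand₃ : ∀ a₁ a₂ a₃ p₁ p₂ p₃ n₁ n₂ n₃ → (a₂ * p₃ - a₃ * p₂) * n₂ - (a₃ * p₁ - a₁ * p₃) * n₁
      ≡ (n₁ * a₁ + n₂ * a₂ + n₃ * a₃) * p₃ - (n₁ * p₁ + n₂ * p₂ + n₃ * p₃) * a₃
    expand₃ = solve-∀

module Norm where

  open import Data.Nat using (_+_; _*_; _≤_; _<_; _⊔_)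
  open Vectors

  ‖_‖ : Point → ℕ
  ‖ x , y , z ‖ = ∣ x ∣ ⊔ ∣ y ∣ ⊔ ∣ z ∣

  ∣coord∣≤‖‖ : ∀ i x → ∣ coord i x ∣ ≤ ‖ x ‖
  ∣coord∣≤‖‖ x-axis (x , y , z) = ℕP.≤-trans (ℕP.m≤m⊔n ∣ x ∣ ∣ y ∣) (ℕP.m≤m⊔n _ ∣ z ∣)
  ∣coord∣≤‖‖ y-axis (x , y , z) = ℕP.≤-trans (ℕP.m≤n⊔m ∣ x ∣ ∣ y ∣) (ℕP.m≤m⊔n _ ∣ z ∣)
  ∣coord∣≤‖‖ z-axis (x , y , z) = ℕP.m≤n⊔m (∣ x ∣ ⊔ ∣ y ∣) ∣ z ∣

  ‖‖-lub : ∀ {x b} → (∀ i → ∣ coord i x ∣ ≤ b) → ‖ x ‖ ≤ b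
  ‖‖-lub {_ , _ , _} h = ℕP.⊔-lub (ℕP.⊔-lub (h x-axis) (h y-axis)) (h z-axis)

  ‖‖-attained : ∀ x → ∃[ i ] ∣ coord i x ∣ ≡ ‖ x ‖
  ‖‖-attained (x , y , z) with ℕP.⊔-sel (∣ x ∣ ⊔ ∣ y ∣) ∣ z ∣ | ℕP.⊔-sel ∣ x ∣ ∣ y ∣
  ... | inj₂ e | _      = z-axis , sym e
  ... | inj₁ e | inj₁ f = x-axis , sym (trans e f)
  ... | inj₁ e | inj₂ f = y-axis , sym (trans e f)

  ‖‖>0 : ∀ {x} → x ≢ origin → 0 < ‖ x ‖
  ‖‖>0 {x} x≢0 = ℕP.<-≤-trans (ℕ.>-nonZero⁻¹ _ {{ℤ.≢-nonZero (proj₂ (nonzero-coord x≢0))}}) (∣coord∣≤‖‖ (proj₁ (nonzero-coord x≢0)) x)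

  ‖⨯‖≤ : ∀ x y → ‖ x ⨯ y ‖ ≤ 2 * (‖ x ‖ * ‖ y ‖)
  ‖⨯‖≤ x@(_ , _ , _) y@(_ , _ , _) = ‖‖-lub {x ⨯ y} λ
    { x-axis → minor y-axis z-axis
    ; y-axis → minor z-axis x-axis
    ; z-axis → minor x-axis y-axis }
    where
    minor : ∀ i j → ∣ coord i x ℤ.* coord j y ℤ.- coord j x ℤ.* coord i y ∣ ≤ 2 * (‖ x ‖ * ‖ y ‖)
    minor i j = begin
      ∣ coord i x ℤ.* coord j y ℤ.- coord j x ℤ.* coord i y ∣
        ≤⟨ ℤP.∣i-j∣≤∣i∣+∣j∣ (coord i x ℤ.* coord j y) (coord j x ℤ.* coord i y) ⟩
      ∣ coord i x ℤ.* coord j y ∣ + ∣ coord j x ℤ.* coord i y ∣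
        ≡⟨ cong₂ _+_ (ℤP.abs-* (coord i x) (coord j y)) (ℤP.abs-* (coord j x) (coord i y)) ⟩
      ∣ coord i x ∣ * ∣ coord j y ∣ + ∣ coord j x ∣ * ∣ coord i y ∣
        ≤⟨ ℕP.+-mono-≤ (ℕP.*-mono-≤ (∣coord∣≤‖‖ i x) (∣coord∣≤‖‖ j y)) (ℕP.*-mono-≤ (∣coord∣≤‖‖ j x) (∣coord∣≤‖‖ i y)) ⟩
      ‖ x ‖ * ‖ y ‖ + ‖ x ‖ * ‖ y ‖
        ≡⟨ cong (_+_ (‖ x ‖ * ‖ y ‖)) (ℕP.+-identityʳ (‖ x ‖ * ‖ y ‖)) ⟨
      2 * (‖ x ‖ * ‖ y ‖) ∎
      where open ℕP.≤-Reasoning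

  ‖·ᵥ‖ : ∀ k x → ‖ k ·ᵥ x ‖ ≡ ∣ k ∣ * ‖ x ‖
  ‖·ᵥ‖ k (x₁ , x₂ , x₃) = begin
    ∣ k ℤ.* x₁ ∣ ⊔ ∣ k ℤ.* x₂ ∣ ⊔ ∣ k ℤ.* x₃ ∣                ≡⟨ cong₂ _⊔_ (cong₂ _⊔_ (ℤP.abs-* k x₁) (ℤP.abs-* k x₂)) (ℤP.abs-* k x₃) ⟩
    ∣ k ∣ * ∣ x₁ ∣ ⊔ ∣ k ∣ * ∣ x₂ ∣ ⊔ ∣ k ∣ * ∣ x₃ ∣          ≡⟨ cong (_⊔ ∣ k ∣ * ∣ x₃ ∣) (ℕP.*-distribˡ-⊔ (∣ k ∣) (∣ x₁ ∣) (∣ x₂ ∣)) ⟨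
    ∣ k ∣ * (∣ x₁ ∣ ⊔ ∣ x₂ ∣) ⊔ ∣ k ∣ * ∣ x₃ ∣                 ≡⟨ ℕP.*-distribˡ-⊔ (∣ k ∣) (∣ x₁ ∣ ⊔ ∣ x₂ ∣) (∣ x₃ ∣) ⟨
    ∣ k ∣ * (∣ x₁ ∣ ⊔ ∣ x₂ ∣ ⊔ ∣ x₃ ∣)                         ∎
    where open ≡-Reasoning

  -- Euclidean division of y by a along a coordinate i where a is longest: the
  -- remainder e = y - k a is parallel to a, so each |eⱼ| = ρ |aⱼ| / |aᵢ| ≤ ρ < ‖ a ‖.
  ∥-division : ∀ {a} y → a ≢ origin → y ∥ a → ∃[ k ] ‖ y -ᵥ k ·ᵥ a ‖ < ‖ a ‖
  ∥-division {a} y a≢0 y∥a = k , ℕP.≤-<-trans ‖e‖≤ρ (subst (ρ <_) ∣aᵢ∣≡‖a‖ (ℤD.n%d<d (coord i y) (coord i a)))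
    where
    i = proj₁ (‖‖-attained a)
    ∣aᵢ∣≡‖a‖ = proj₂ (‖‖-attained a)
    aᵢ≢0 : coord i a ≢ 0ℤ
    aᵢ≢0 aᵢ≡0 = ℕP.<-irrefl (trans (sym (cong ∣_∣ aᵢ≡0)) ∣aᵢ∣≡‖a‖) (‖‖>0 a≢0)
    instance
      aᵢ-nonZero : ℤ.NonZero (coord i a)
      aᵢ-nonZero = ℤ.≢-nonZero aᵢ≢0
    k = coord i y ℤ./ coord i a
    ρ = coord i y ℤ.% coord i a
    e = y -ᵥ k ·ᵥ a
    eᵢ≡ρ : coord i e ≡ + ρ
    eᵢ≡ρ = begin
      coord i e                                 ≡⟨ trans (coord-sub i y (k ·ᵥ a)) (cong (ℤ._-_ (coord i y)) (coord-scale i k a)) ⟩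
      coord i y ℤ.- k ℤ.* coord i a             ≡⟨ cong (ℤ._- k ℤ.* coord i a) (ℤD.a≡a%n+[a/n]*n (coord i y) (coord i a)) ⟩
      + ρ ℤ.+ k ℤ.* coord i a ℤ.- k ℤ.* coord i a ≡⟨ add-sub (+ ρ) (k ℤ.* coord i a) ⟩
      + ρ ∎
      where
      open ≡-Reasoning
      add-sub : ∀ r t → r ℤ.+ t ℤ.- t ≡ r
      add-sub = solve-∀
    e∥a : e ∥ a
    e∥a = ∥-sub-scaled k y∥a (∥-refl a)
    ‖e‖≤ρ : ‖ e ‖ ≤ ρ
    ‖e‖≤ρ = ‖‖-lub {e} λ j → ℕP.*-cancelʳ-≤ _ _ _ (begin
      ∣ coord j e ∣ * ∣ coord i a ∣   ≡⟨ ℤP.abs-* (coord j e) (coord i a) ⟨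
      ∣ coord j e ℤ.* coord i a ∣     ≡⟨ cong ∣_∣ (∥⇒coord e∥a i j) ⟨
      ∣ coord i e ℤ.* coord j a ∣     ≡⟨ trans (ℤP.abs-* (coord i e) (coord j a)) (cong (λ c → ∣ c ∣ * ∣ coord j a ∣) eᵢ≡ρ) ⟩
      ρ * ∣ coord j a ∣               ≤⟨ ℕP.*-monoʳ-≤ ρ (subst (∣ coord j a ∣ ≤_) (sym ∣aᵢ∣≡‖a‖) (∣coord∣≤‖‖ j a)) ⟩
      ρ * ∣ coord i a ∣               ∎)
      where open ℕP.≤-Reasoning

module Boxes where

  open import Data.Nat using (_+_; _*_; _^_; _≤_)
  open Counting
  open Vectors
  open Norm

  range : ℕ → List ℤ
  range zero    = 0ℤ ∷ []
  range (suc K) = + suc K ∷ -[1+ K ] ∷ range K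

  ∈-range⁺ : ∀ {K x} → ∣ x ∣ ≤ K → x ∈ range K
  ∈-range⁺ {zero} ∣x∣≤0 = here (ℤP.∣i∣≡0⇒i≡0 (ℕP.n≤0⇒n≡0 ∣x∣≤0))
  ∈-range⁺ {suc K} {x} ∣x∣≤1+K with ℕP.m≤n⇒m<n∨m≡n ∣x∣≤1+K
  ∈-range⁺ {suc K} {x}        _ | inj₁ ∣x∣<1+K = there (there (∈-range⁺ (ℕ.s≤s⁻¹ ∣x∣<1+K)))
  ∈-range⁺ {suc K} {+ _}      _ | inj₂ refl    = here refl
  ∈-range⁺ {suc K} { -[1+ _ ]} _ | inj₂ refl    = there (here refl)

  ∈-range⁻ : ∀ {K x} → x ∈ range K → ∣ x ∣ ≤ K
  ∈-range⁻ {zero}  (here refl)         = z≤n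
  ∈-range⁻ {suc K} (here refl)         = ℕP.≤-refl
  ∈-range⁻ {suc K} (there (here refl)) = ℕP.≤-refl
  ∈-range⁻ {suc K} (there (there x∈))  = ℕP.m≤n⇒m≤1+n (∈-range⁻ x∈)

  length-range : ∀ K → length (range K) ≡ 1 + 2 * K
  length-range zero    = refl
  length-range (suc K) = cong (λ l → 2 + l) (trans (length-range K) (sym (ℕP.+-suc K (K + 0))))

  range-unique : ∀ K → Unique (range K)
  range-unique zero    = [] ∷ []
  range-unique (suc K) = All.tabulate top-fresh ∷ All.tabulate bottom-fresh ∷ range-unique K
    where
    top-fresh : ∀ {x} → x ∈ -[1+ K ] ∷ range K → + suc K ≢ x
    top-fresh (here refl) ()
    top-fresh (there x∈) refl = ℕP.<-irrefl refl (∈-range⁻ x∈)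
    bottom-fresh : ∀ {x} → x ∈ range K → -[1+ K ] ≢ x
    bottom-fresh x∈ refl = ℕP.<-irrefl refl (∈-range⁻ x∈)

  box : ℕ → List Point
  box K = cube (range K)

  ∈-box⁺ : ∀ {K x} → ‖ x ‖ ≤ K → x ∈ box K
  ∈-box⁺ {K} {x} ‖x‖≤K = ∈-cube⁺ (bounded x-axis) (bounded y-axis) (bounded z-axis)
    where
    bounded : ∀ i → coord i x ∈ range K
    bounded i = ∈-range⁺ (ℕP.≤-trans (∣coord∣≤‖‖ i x) ‖x‖≤K)

  ∈-box⁻ : ∀ {K x} → x ∈ box K → ‖ x ‖ ≤ K
  ∈-box⁻ {K} {x , y , z} x∈ with ∈-cube⁻ x∈
  ... | x∈ , y∈ , z∈ = ℕP.⊔-lub (ℕP.⊔-lub (∈-range⁻ x∈) (∈-range⁻ y∈)) (∈-range⁻ z∈)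

  length-box : ∀ K → length (box K) ≡ (1 + 2 * K) ^ 3
  length-box K = trans (length-cube (range K)) (cong (_^ 3) (length-range K))

  box-unique : ∀ K → Unique (box K)
  box-unique K = cube-unique (range-unique K)

module ShortestVectors where

  open import Data.Nat using (_≤_)
  open Vectors
  open Norm
  open Boxes

  record Shortest (Q : Point → Set) (a : Point) : Set where
    field
      member  : Q a
      nonzero : a ≢ origin
      minimal : ∀ {e} → Q e → e ≢ origin → ‖ a ‖ ≤ ‖ e ‖

  -- Search the box of radius ‖ x ‖, which contains every non-zero member of Q no longer than x.
  shortest-exists : ∀ {Q} → Decidable Q → ∀ {x} → Q x → x ≢ origin → ∃ (Shortest Q)
  shortest-exists {Q} Q? {x} Qx x≢0 = a , record { member = proj₁ candidate-a ; nonzero = proj₂ candidate-a ; minimal = minimal }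
    where
    Candidate : Point → Set
    Candidate e = Q e × e ≢ origin
    candidate? : Decidable Candidate
    candidate? e = Q? e ×-dec ¬? (e ≟ᵥ origin)
    candidates : List Point
    candidates = filter candidate? (box ‖ x ‖)
    a : Point
    a = argmin ‖_‖ x candidates
    candidate-a : Candidate a
    candidate-a = argmin-all ‖_‖ {P = Candidate} (Qx , x≢0) (all-filter candidate? (box ‖ x ‖))
    minimal : ∀ {e} → Q e → e ≢ origin → ‖ a ‖ ≤ ‖ e ‖
    minimal {e} Qe e≢0 with ‖ e ‖ ℕ.≤? ‖ x ‖
    ... | yes ‖e‖≤‖x‖ = All.lookup (f[argmin]≤f[xs] {f = ‖_‖} x candidates) (∈-filter⁺ candidate? (∈-box⁺ ‖e‖≤‖x‖) (Qe , e≢0))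
    ... | no ‖e‖≰‖x‖ = ℕP.≤-trans (f[argmin]≤f[⊤] {f = ‖_‖} x candidates) (ℕP.<⇒≤ (ℕP.≰⇒> ‖e‖≰‖x‖))

  -- The remainder of y after division by a is a member of Q shorter than a, hence zero.
  shortest-divides : ∀ {Q a} → Shortest Q a → (∀ {y} k → Q y → Q (y -ᵥ k ·ᵥ a)) →
    ∀ {y} → Q y → y ∥ a → ∃[ k ] y ≡ k ·ᵥ a
  shortest-divides {Q} {a} a-short closed {y} Qy y∥a = k , -ᵥ≡origin⇒≡ y (k ·ᵥ a) remainder≡0
    where
    open Shortest a-short
    k = proj₁ (∥-division y nonzero y∥a)
    remainder≡0 : y -ᵥ k ·ᵥ a ≡ origin
    remainder≡0 = decidable-stable (y -ᵥ k ·ᵥ a ≟ᵥ origin) λ remainder≢0 →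
      ℕP.<⇒≱ (proj₂ (∥-division y nonzero y∥a)) (minimal (closed k Qy) remainder≢0)

  Primitive : Point → Set
  Primitive n = Shortest (_∥ n) n

  primitive-multiple : ∀ {n y} → Primitive n → y ∥ n → ∃[ k ] y ≡ k ·ᵥ n
  primitive-multiple {n} n-prim y∥n = shortest-divides n-prim (λ k y∥n → ∥-sub-scaled k y∥n (∥-refl n)) y∥n y∥n

  primitive-exists : ∀ {m} → m ≢ origin → ∃[ n ] Primitive n × n ∥ m × ‖ n ‖ ≤ ‖ m ‖
  primitive-exists {m} m≢0 = n , n-primitive , member , minimal (∥-refl m) m≢0
    where
    shortest = shortest-exists (_∥? m) (∥-refl m) m≢0
    n = proj₁ shortest
    open Shortest (proj₂ shortest)
    n-primitive : Primitive n
    n-primitive = record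
      { member  = ∥-refl n
      ; nonzero = nonzero
      ; minimal = λ {e} e∥n e≢0 → minimal (∥-trans {e} nonzero e∥n member) e≢0
      }

module LatticePlanes where

  open import Data.Nat using (_+_; _*_; _≤_; _<_; _/_)
  import Data.Nat.DivMod as ℕD
  open Counting
  open Vectors
  open Norm
  open Boxes
  open ShortestVectors
  open Arithmetic

  InPlaneBox : ℕ → Point → Point → Set
  InPlaneBox K n x = ‖ x ‖ ≤ K × n ⊥ x

  planePoints : ℕ → Point → List Point
  planePoints K n = filter (n ⊥?_) (box K)

  ∈-planePoints⁺ : ∀ {K n x} → InPlaneBox K n x → x ∈ planePoints K n
  ∈-planePoints⁺ (‖x‖≤K , n⊥x) = ∈-filter⁺ _ (∈-box⁺ ‖x‖≤K) n⊥x

  planePoints-inPlaneBox : ∀ K n → All (InPlaneBox K n) (planePoints K n)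
  planePoints-inPlaneBox K n = All.tabulate λ x∈ →
    let x∈box , n⊥x = ∈-filter⁻ _ {xs = box K} x∈ in ∈-box⁻ x∈box , n⊥x

  planePoints-unique : ∀ K n → Unique (planePoints K n)
  planePoints-unique K n = Unique.filter⁺ _ (box-unique K)

  -- A plane point p is determined by the multiple k of n that a ⨯ p is, and by the
  -- block of length ‖ a ‖ containing its coordinate pᵢ, where |aᵢ| = ‖ a ‖.
  module _ {K : ℕ} {n a : Point} (n-prim : Primitive n) (a-short : Shortest (n ⊥_) a) where

    private
      r = ‖ a ‖
      h = ‖ n ‖
      n⊥a = Shortest.member a-short
      a≢0 = Shortest.nonzero a-short
      n≢0 = Shortest.nonzero n-prim
      i = proj₁ (‖‖-attained a)
      j = proj₁ (nonzero-coord n≢0)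
      instance
        r-nonZero : ℕ.NonZero r
        r-nonZero = ℕ.>-nonZero (‖‖>0 a≢0)
        h-nonZero : ℕ.NonZero h
        h-nonZero = ℕ.>-nonZero (‖‖>0 n≢0)
      nⱼ-nonZero : ℤ.NonZero (coord j n)
      nⱼ-nonZero = ℤ.≢-nonZero (proj₂ (nonzero-coord n≢0))

      T = 2 * (r * K) / h
      D = 2 * K / r

      key : Point → ℤ × ℕ
      key p = coord j (a ⨯ p) , ∣ coord i p ℤ.+ + K ∣ / r

      keys : List (ℤ × ℕ)
      keys = cartesianProduct (map (ℤ._* coord j n) (range T)) (upTo (suc D))

      ⨯-multiple : ∀ {p} → n ⊥ p → ∃[ k ] a ⨯ p ≡ k ·ᵥ n
      ⨯-multiple n⊥p = primitive-multiple n-prim (⊥⊥⇒⨯∥ n⊥a n⊥p)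

      ∣multiple∣*h≤ : ∀ p k → ‖ p ‖ ≤ K → a ⨯ p ≡ k ·ᵥ n → ∣ k ∣ * h ≤ 2 * (r * K)
      ∣multiple∣*h≤ p k ‖p‖≤K a⨯p≡kn = begin
        ∣ k ∣ * h          ≡⟨ trans (cong ‖_‖ a⨯p≡kn) (‖·ᵥ‖ k n) ⟨
        ‖ a ⨯ p ‖          ≤⟨ ‖⨯‖≤ a p ⟩
        2 * (r * ‖ p ‖)    ≤⟨ ℕP.*-monoʳ-≤ 2 (ℕP.*-monoʳ-≤ r ‖p‖≤K) ⟩
        2 * (r * K)        ∎
        where open ℕP.≤-Reasoning

      key∈keys : ∀ {p} → InPlaneBox K n p → key p ∈ keys
      key∈keys {p} (‖p‖≤K , n⊥p) = ∈-cartesianProduct⁺ multiple∈ block∈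
        where
        k = proj₁ (⨯-multiple n⊥p)
        a⨯p≡kn = proj₂ (⨯-multiple n⊥p)
        multiple∈ : coord j (a ⨯ p) ∈ map (ℤ._* coord j n) (range T)
        multiple∈ = subst (_∈ map (ℤ._* coord j n) (range T)) (sym (trans (cong (coord j) a⨯p≡kn) (coord-scale j k n)))
          (∈-map⁺ (ℤ._* coord j n) (∈-range⁺ {T} {k} (m*n≤o⇒m≤o/n ∣ k ∣ h (∣multiple∣*h≤ p k ‖p‖≤K a⨯p≡kn))))
        block∈ : ∣ coord i p ℤ.+ + K ∣ / r ∈ upTo (suc D)
        block∈ = ∈-upTo⁺ (s≤s (ℕD./-monoˡ-≤ r (begin
          ∣ coord i p ℤ.+ + K ∣       ≤⟨ ℤP.∣i+j∣≤∣i∣+∣j∣ (coord i p) (+ K) ⟩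
          ∣ coord i p ∣ + K           ≤⟨ ℕP.+-monoˡ-≤ K (ℕP.≤-trans (∣coord∣≤‖‖ i p) ‖p‖≤K) ⟩
          K + K                       ≡⟨ cong (_+_ K) (ℕP.+-identityʳ K) ⟨
          2 * K                       ∎)))
          where open ℕP.≤-Reasoning

      a⨯-injective : ∀ {p q} → n ⊥ p → n ⊥ q → coord j (a ⨯ p) ≡ coord j (a ⨯ q) → a ⨯ p ≡ a ⨯ q
      a⨯-injective {p} {q} n⊥p n⊥q a⨯pⱼ≡a⨯qⱼ = trans a⨯p≡kₚn (trans (cong (_·ᵥ n) kₚ≡k_q) (sym a⨯q≡k_qn))
        where
        open ≡-Reasoning
        kₚ = proj₁ (⨯-multiple n⊥p)
        a⨯p≡kₚn = proj₂ (⨯-multiple n⊥p)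
        k_q = proj₁ (⨯-multiple n⊥q)
        a⨯q≡k_qn = proj₂ (⨯-multiple n⊥q)
        kₚ≡k_q : kₚ ≡ k_q
        kₚ≡k_q = ℤP.*-cancelʳ-≡ kₚ k_q (coord j n) {{nⱼ-nonZero}} (begin
          kₚ ℤ.* coord j n     ≡⟨ trans (cong (coord j) a⨯p≡kₚn) (coord-scale j kₚ n) ⟨
          coord j (a ⨯ p)      ≡⟨ a⨯pⱼ≡a⨯qⱼ ⟩
          coord j (a ⨯ q)      ≡⟨ trans (cong (coord j) a⨯q≡k_qn) (coord-scale j k_q n) ⟩
          k_q ℤ.* coord j n    ∎)

      same-block⇒close : ∀ {p q} → ‖ p ‖ ≤ K → ‖ q ‖ ≤ K →
        ∣ coord i p ℤ.+ + K ∣ / r ≡ ∣ coord i q ℤ.+ + K ∣ / r → ∣ coord i (p -ᵥ q) ∣ < r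
      same-block⇒close {p} {q} ‖p‖≤K ‖q‖≤K same-block = begin-strict
        ∣ coord i (p -ᵥ q) ∣                            ≡⟨ cong ∣_∣ (trans (coord-sub i p q) (shift (coord i p) (coord i q) (+ K))) ⟩
        ∣ (coord i p ℤ.+ + K) ℤ.- (coord i q ℤ.+ + K) ∣ ≡⟨ cong ∣_∣ (cong₂ ℤ._-_ (∣i∣≤K⇒+∣i+K∣≡i+K (coord i p) ∣pᵢ∣≤K) (∣i∣≤K⇒+∣i+K∣≡i+K (coord i q) ∣qᵢ∣≤K)) ⟨
        ∣ + X ℤ.- + Y ∣                                 ≡⟨ cong ∣_∣ (ℤP.[+m]-[+n]≡m⊖n X Y) ⟩
        ∣ X ℤ.⊖ Y ∣                                     <⟨ x/r≡y/r⇒∣x⊖y∣<r X Y r same-block ⟩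
        r                                               ∎
        where
        open ℕP.≤-Reasoning
        X = ∣ coord i p ℤ.+ + K ∣
        Y = ∣ coord i q ℤ.+ + K ∣
        shift : ∀ x y c → x ℤ.- y ≡ (x ℤ.+ c) ℤ.- (y ℤ.+ c)
        shift = solve-∀
        ∣pᵢ∣≤K = ℕP.≤-trans (∣coord∣≤‖‖ i p) ‖p‖≤K
        ∣qᵢ∣≤K = ℕP.≤-trans (∣coord∣≤‖‖ i q) ‖q‖≤K

      -- p - q is a multiple l a, and |l| ‖ a ‖ = |pᵢ - qᵢ| < ‖ a ‖ forces l = 0.
      key-injective : InjectiveOn (InPlaneBox K n) key
      key-injective {p} {q} (‖p‖≤K , n⊥p) (‖q‖≤K , n⊥q) key≡ =
        -ᵥ≡origin⇒≡ p q (trans p-q≡la (trans (cong (_·ᵥ a) l≡0) (0·ᵥ≡origin a)))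
        where
        p-q-multiple : ∃[ l ] p -ᵥ q ≡ l ·ᵥ a
        p-q-multiple = shortest-divides a-short (λ k n⊥y → ⊥-sub-scaled k n⊥y n⊥a) (⊥-sub n⊥p n⊥q)
          (⨯-cancelˡ a p q (a⨯-injective n⊥p n⊥q (cong proj₁ key≡)))
        l = proj₁ p-q-multiple
        p-q≡la = proj₂ p-q-multiple
        l≡0 : l ≡ 0ℤ
        l≡0 = ∣i∣*r<r⇒i≡0 l r (begin-strict
          ∣ l ∣ * r               ≡⟨ cong (∣ l ∣ *_) (proj₂ (‖‖-attained a)) ⟨
          ∣ l ∣ * ∣ coord i a ∣   ≡⟨ ℤP.abs-* l (coord i a) ⟨
          ∣ l ℤ.* coord i a ∣     ≡⟨ cong ∣_∣ (trans (cong (coord i) p-q≡la) (coord-scale i l a)) ⟨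
          ∣ coord i (p -ᵥ q) ∣    <⟨ same-block⇒close ‖p‖≤K ‖q‖≤K (cong proj₂ key≡) ⟩
          r                       ∎)
          where open ℕP.≤-Reasoning

      length-planePoints-≤ : length (planePoints K n) ≤ (1 + 2 * T) * (1 + D)
      length-planePoints-≤ = begin
        length (planePoints K n)   ≤⟨ countAtMost-injection key keys key-injective key∈keys
                                        (planePoints K n) (planePoints-unique K n) (planePoints-inPlaneBox K n) ⟩
        length keys                ≡⟨ length-cartesianProduct (map (ℤ._* coord j n) (range T)) (upTo (suc D)) ⟩
        length (map (ℤ._* coord j n) (range T)) * length (upTo (suc D))
                                   ≡⟨ cong₂ _*_ (trans (LP.length-map _ (range T)) (length-range T)) (LP.length-upTo (suc D)) ⟩
        (1 + 2 * T) * (1 + D)      ∎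
        where open ℕP.≤-Reasoning

    shortest⇒length-planePoints*‖n‖≤ : ∀ {p} → InPlaneBox K n p → ¬ a ∥ p → length (planePoints K n) * ‖ n ‖ ≤ 18 * (K * K)
    shortest⇒length-planePoints*‖n‖≤ {p} (‖p‖≤K , n⊥p) a∦p = ℕP.≤-trans (ℕP.*-monoˡ-≤ h length-planePoints-≤)
      ([1+2T]*[1+D]*h≤18K² T D r≤K h≤2rK (ℕD.m/n*n≤m (2 * (r * K)) h) (ℕD.m/n*n≤m (2 * K) r))
      where
      k = proj₁ (⨯-multiple n⊥p)
      a⨯p≡kn = proj₂ (⨯-multiple n⊥p)
      p≢0 : p ≢ origin
      p≢0 refl = a∦p (∥-sym (origin-∥ a))
      r≤K : r ≤ K
      r≤K = ℕP.≤-trans (Shortest.minimal a-short n⊥p p≢0) ‖p‖≤K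
      k≢0 : k ≢ 0ℤ
      k≢0 k≡0 = a∦p (parallel (trans a⨯p≡kn (trans (cong (_·ᵥ n) k≡0) (0·ᵥ≡origin n))))
      h≤2rK : h ≤ 2 * (r * K)
      h≤2rK = ℕP.≤-trans (ℕP.m≤n*m h ∣ k ∣ {{ℤ.≢-nonZero k≢0}}) (∣multiple∣*h≤ p k ‖p‖≤K a⨯p≡kn)

  length-planePoints*‖n‖≤ : ∀ {K n a b} → Primitive n → InPlaneBox K n a → InPlaneBox K n b → ¬ a ∥ b →
    length (planePoints K n) * ‖ n ‖ ≤ 18 * (K * K)
  length-planePoints*‖n‖≤ {K} {n} {a} {b} n-prim a∈ b∈ a∦b
    with shortest-exists (n ⊥?_) (proj₂ a∈) (λ { refl → a∦b (origin-∥ b) })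
  ... | s , s-short with s ∥? a | s ∥? b
  ...   | no s∦a  | _       = shortest⇒length-planePoints*‖n‖≤ n-prim s-short a∈ s∦a
  ...   | yes _   | no s∦b  = shortest⇒length-planePoints*‖n‖≤ n-prim s-short b∈ s∦b
  ...   | yes s∥a | yes s∥b = ⊥-elim (a∦b (∥-trans (Shortest.nonzero s-short) (∥-sym s∥a) s∥b))

module CoplanarTriples where

  open import Data.Nat using (_+_; _*_; _^_; _≤_; _<_; _≤?_; _/_)
  import Data.Nat.DivMod as ℕD
  open Counting
  open Vectors
  open Norm
  open Boxes
  open ShortestVectors
  open Arithmetic
  open LatticePlanes

  Coplanar₀ : Point → Point → Point → Set
  Coplanar₀ u v w = ∃[ ν ] ν ≢ origin × ν ⊥ u × ν ⊥ v × ν ⊥ w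

  SpannedInBox : ℕ → Point → Point → Point → Set
  SpannedInBox K u v w = ∃₂ λ a b → ‖ a ‖ ≤ K × ‖ b ‖ ≤ K × ¬ a ∥ b × a ⨯ b ⊥ u × a ⨯ b ⊥ v × a ⨯ b ⊥ w

  e₁ e₂ : Point
  e₁ = 1ℤ , 0ℤ , 0ℤ
  e₂ = 0ℤ , 1ℤ , 0ℤ

  -- d ∥ e₁ forces d₂ = d₃ = 0 and d ∥ e₂ forces d₁ = 0.
  unit-not-parallel : ∀ {d} → d ≢ origin → ∃[ e ] ‖ e ‖ ≡ 1 × ¬ d ∥ e
  unit-not-parallel {d} d≢0 with d ∥? e₁ | d ∥? e₂
  ... | no d∦e₁  | _        = e₁ , refl , d∦e₁
  ... | yes _    | no d∦e₂  = e₂ , refl , d∦e₂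
  ... | yes d∥e₁ | yes d∥e₂ = ⊥-elim (d≢0 (coord-ext λ
    { x-axis → vanishes (coord x-axis d) (coord y-axis d) (∥⇒coord d∥e₂ x-axis y-axis)
    ; y-axis → vanishes (coord y-axis d) (coord x-axis d) (∥⇒coord d∥e₁ y-axis x-axis)
    ; z-axis → vanishes (coord z-axis d) (coord x-axis d) (∥⇒coord d∥e₁ z-axis x-axis) }))
    where
    vanishes : ∀ a b → a ℤ.* 1ℤ ≡ b ℤ.* 0ℤ → a ≡ 0ℤ
    vanishes a b e = trans (sym (ℤP.*-identityʳ a)) (trans e (ℤP.*-zeroʳ b))

  line-spanned : ∀ {K d u v w} → 1 ≤ K → d ≢ origin → ‖ d ‖ ≤ K → d ∥ u → d ∥ v → d ∥ w → SpannedInBox K u v w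
  line-spanned {K} {d} 1≤K d≢0 ‖d‖≤K d∥u d∥v d∥w with unit-not-parallel d≢0
  ... | e , ‖e‖≡1 , d∦e = d , e , ‖d‖≤K , subst (_≤ K) (sym ‖e‖≡1) 1≤K , d∦e , on-line d∥u , on-line d∥v , on-line d∥w
    where
    on-line : ∀ {x} → d ∥ x → d ⨯ e ⊥ x
    on-line d∥x = ⊥-sym (∥-⊥ d≢0 d∥x (⊥-sym (⨯-⊥ˡ d e)))

  common-normal-spanned : ∀ {K ν a b u v w} → ν ≢ origin → ‖ a ‖ ≤ K → ‖ b ‖ ≤ K → ¬ a ∥ b →
    ν ⊥ a → ν ⊥ b → ν ⊥ u → ν ⊥ v → ν ⊥ w → SpannedInBox K u v w
  common-normal-spanned {a = a} {b} ν≢0 ‖a‖≤K ‖b‖≤K a∦b ν⊥a ν⊥b ν⊥u ν⊥v ν⊥w =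
    a , b , ‖a‖≤K , ‖b‖≤K , a∦b , through ν⊥u , through ν⊥v , through ν⊥w
    where
    through : ∀ {x} → _ ⊥ x → a ⨯ b ⊥ x
    through = ∥-⊥ ν≢0 (∥-sym (⊥⊥⇒⨯∥ ν⊥a ν⊥b))

  coplanar₀-spanned : ∀ {K u v w} → 1 ≤ K → ‖ u ‖ ≤ K → ‖ v ‖ ≤ K → ‖ w ‖ ≤ K → Coplanar₀ u v w → SpannedInBox K u v w
  coplanar₀-spanned {K} {u} {v} {w} 1≤K ‖u‖≤K ‖v‖≤K ‖w‖≤K (ν , ν≢0 , ν⊥u , ν⊥v , ν⊥w)
    with u ∥? v | u ∥? w | v ∥? w
  ... | no u∦v | _      | _      = common-normal-spanned ν≢0 ‖u‖≤K ‖v‖≤K u∦v ν⊥u ν⊥v ν⊥u ν⊥v ν⊥w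
  ... | yes _  | no u∦w | _      = common-normal-spanned ν≢0 ‖u‖≤K ‖w‖≤K u∦w ν⊥u ν⊥w ν⊥u ν⊥v ν⊥w
  ... | yes _  | yes _  | no v∦w = common-normal-spanned ν≢0 ‖v‖≤K ‖w‖≤K v∦w ν⊥v ν⊥w ν⊥u ν⊥v ν⊥w
  ... | yes u∥v | yes u∥w | yes v∥w with u ≟ᵥ origin | v ≟ᵥ origin | w ≟ᵥ origin
  ...   | no u≢0   | _        | _        = line-spanned 1≤K u≢0 ‖u‖≤K (∥-refl u) u∥v u∥w
  ...   | yes refl | no v≢0   | _        = line-spanned 1≤K v≢0 ‖v‖≤K (∥-sym (origin-∥ v)) (∥-refl v) v∥w
  ...   | yes refl | yes refl | no w≢0   = line-spanned 1≤K w≢0 ‖w‖≤K (∥-sym (origin-∥ w)) (∥-sym (origin-∥ w)) (∥-refl w)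
  ...   | yes refl | yes refl | yes refl = line-spanned 1≤K (λ ()) 1≤K (∥-sym (origin-∥ e₁)) (∥-sym (origin-∥ e₁)) (∥-sym (origin-∥ e₁))

  SparseNormal : ℕ → Point → Point → Point → Point → Set
  SparseNormal K u v w n =
    n ≢ origin × ‖ n ‖ ≤ 2 * (K * K) × length (planePoints K n) * ‖ n ‖ ≤ 18 * (K * K) × n ⊥ u × n ⊥ v × n ⊥ w

  spanned⇒sparseNormal : ∀ {K u v w} → SpannedInBox K u v w → ∃ (SparseNormal K u v w)
  spanned⇒sparseNormal {K} (a , b , ‖a‖≤K , ‖b‖≤K , a∦b , m⊥u , m⊥v , m⊥w) =
    n , Shortest.nonzero n-prim , ‖n‖≤2K² ,
    length-planePoints*‖n‖≤ n-prim (‖a‖≤K , to-n (⨯-⊥ˡ a b)) (‖b‖≤K , to-n (⨯-⊥ʳ a b)) a∦b ,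
    to-n m⊥u , to-n m⊥v , to-n m⊥w
    where
    primitive-normal = primitive-exists {a ⨯ b} (a∦b ∘ parallel)
    n = proj₁ primitive-normal
    n-prim = proj₁ (proj₂ primitive-normal)
    to-n : ∀ {x} → a ⨯ b ⊥ x → n ⊥ x
    to-n = ∥-⊥ (a∦b ∘ parallel) (∥-sym (proj₁ (proj₂ (proj₂ primitive-normal))))
    ‖n‖≤2K² : ‖ n ‖ ≤ 2 * (K * K)
    ‖n‖≤2K² = ℕP.≤-trans (proj₂ (proj₂ (proj₂ primitive-normal)))
      (ℕP.≤-trans (‖⨯‖≤ a b) (ℕP.*-monoʳ-≤ 2 (ℕP.*-mono-≤ ‖a‖≤K ‖b‖≤K)))

  -- Shell j lists the plane triples of the normals n with ‖ n ‖ ≤ 2 ^ (1 + j) whose plane has at most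
  -- 18 K² / 2 ^ j points in the box of radius K.
  Sparse : ℕ → ℕ → Point → Set
  Sparse K j n = length (planePoints K n) * 2 ^ j ≤ 18 * (K * K)

  sparse? : ∀ K j → Decidable (Sparse K j)
  sparse? K j n = length (planePoints K n) * 2 ^ j ≤? 18 * (K * K)

  shellTriples : ℕ → ℕ → List (Point × Point × Point)
  shellTriples K j = concatMap (cube ∘ planePoints K) (filter (sparse? K j) (box (2 ^ suc j)))

  coplanarTriples : ℕ → ℕ → List (Point × Point × Point)
  coplanarTriples K J = concatMap (shellTriples K) (upTo (suc J))

  sparseNormal⇒∈-coplanarTriples : ∀ {K} J {u v w n} → 2 * (K * K) < 2 ^ suc J →
    ‖ u ‖ ≤ K → ‖ v ‖ ≤ K → ‖ w ‖ ≤ K → SparseNormal K u v w n → (u , v , w) ∈ coplanarTriples K J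
  sparseNormal⇒∈-coplanarTriples {K} J {n = n} 2K²<2^[1+J] ‖u‖≤K ‖v‖≤K ‖w‖≤K (n≢0 , ‖n‖≤2K² , few , n⊥u , n⊥v , n⊥w) =
    ∈-concatMap⁺′ (shellTriples K) {upTo (suc J)} {j} (∈-upTo⁺ {suc J} j<1+J)
      (∈-concatMap⁺′ (cube ∘ planePoints K) {filter (sparse? K j) (box (2 ^ suc j))} {n}
        (∈-filter⁺ (sparse? K j) (∈-box⁺ (ℕP.<⇒≤ ‖n‖<2^[1+j])) sparse)
        (∈-cube⁺ (∈-planePoints⁺ (‖u‖≤K , n⊥u)) (∈-planePoints⁺ (‖v‖≤K , n⊥v)) (∈-planePoints⁺ (‖w‖≤K , n⊥w))))
    where
    scale = dyadic (‖‖>0 n≢0)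
    j = proj₁ scale
    2^j≤‖n‖ = proj₁ (proj₂ scale)
    ‖n‖<2^[1+j] = proj₂ (proj₂ scale)
    j<1+J : j < suc J
    j<1+J = 2^m<2^n⇒m<n (ℕP.≤-<-trans 2^j≤‖n‖ (ℕP.≤-<-trans ‖n‖≤2K² 2K²<2^[1+J]))
    sparse : Sparse K j n
    sparse = ℕP.≤-trans (ℕP.*-monoʳ-≤ (length (planePoints K n)) 2^j≤‖n‖) few

  ∈-coplanarTriples : ∀ {K} J {u v w} → 1 ≤ K → 2 * (K * K) < 2 ^ suc J →
    ‖ u ‖ ≤ K → ‖ v ‖ ≤ K → ‖ w ‖ ≤ K → Coplanar₀ u v w → (u , v , w) ∈ coplanarTriples K J
  ∈-coplanarTriples J 1≤K 2K²<2^[1+J] ‖u‖≤K ‖v‖≤K ‖w‖≤K cop =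
    sparseNormal⇒∈-coplanarTriples J 2K²<2^[1+J] ‖u‖≤K ‖v‖≤K ‖w‖≤K
      (proj₂ (spanned⇒sparseNormal (coplanar₀-spanned 1≤K ‖u‖≤K ‖v‖≤K ‖w‖≤K cop)))

  length-shellTriples : ∀ K j → length (shellTriples K j) ≤ 125 * (18 * (K * K)) ^ 3
  length-shellTriples K j = begin
    length (shellTriples K j)                                   ≤⟨ length-concatMap-≤ (cube ∘ planePoints K) (All.map few (all-filter (sparse? K j) (box (2 ^ suc j)))) ⟩
    length (filter (sparse? K j) (box (2 ^ suc j))) * q ^ 3      ≤⟨ ℕP.*-monoˡ-≤ (q ^ 3) (LP.length-filter (sparse? K j) (box (2 ^ suc j))) ⟩
    length (box (2 ^ suc j)) * q ^ 3                            ≡⟨ cong (_* q ^ 3) (length-box (2 ^ suc j)) ⟩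
    (1 + 2 * (2 * t)) ^ 3 * q ^ 3                               ≤⟨ ℕP.*-monoˡ-≤ (q ^ 3) (ℕP.^-monoˡ-≤ 3 1+4t≤5t) ⟩
    (5 * t) ^ 3 * q ^ 3                                         ≡⟨ regroup t q ⟩
    125 * (q * t) ^ 3                                           ≤⟨ ℕP.*-monoʳ-≤ 125 (ℕP.^-monoˡ-≤ 3 (ℕD.m/n*n≤m B t)) ⟩
    125 * B ^ 3                                                 ∎
    where
    open ℕP.≤-Reasoning
    t = 2 ^ j
    B = 18 * (K * K)
    instance
      t-nonZero : ℕ.NonZero t
      t-nonZero = ℕP.m^n≢0 2 j
    q = B / t
    few : ∀ {n} → Sparse K j n → length (cube (planePoints K n)) ≤ q ^ 3
    few {n} sparse = ℕP.≤-trans (ℕP.≤-reflexive (length-cube (planePoints K n)))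
      (ℕP.^-monoˡ-≤ 3 (m*n≤o⇒m≤o/n (length (planePoints K n)) t sparse))
    1+4t≤5t : 1 + 2 * (2 * t) ≤ 5 * t
    1+4t≤5t = ℕP.≤-trans (ℕP.+-monoˡ-≤ (2 * (2 * t)) (ℕP.m^n>0 2 j)) (ℕP.≤-reflexive (collect t))
      where
      collect : ∀ t → t + 2 * (2 * t) ≡ 5 * t
      collect = ℕ-solve-∀
    regroup : ∀ t q → (5 * t) ^ 3 * q ^ 3 ≡ 125 * (q * t) ^ 3
    regroup t q = cubes t q
      where
      cubes : ∀ t q → 5 * t * (5 * t * (5 * t * 1)) * (q * (q * (q * 1))) ≡ 125 * (q * t * (q * t * (q * t * 1)))
      cubes = ℕ-solve-∀

  length-coplanarTriples : ∀ K J → length (coplanarTriples K J) ≤ suc J * (125 * (18 * (K * K)) ^ 3)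
  length-coplanarTriples K J = begin
    length (coplanarTriples K J)                        ≤⟨ length-concatMap-≤ (shellTriples K) {xs = upTo (suc J)} (All.tabulate λ {j} _ → length-shellTriples K j) ⟩
    length (upTo (suc J)) * (125 * (18 * (K * K)) ^ 3)  ≡⟨ cong (_* (125 * (18 * (K * K)) ^ 3)) (LP.length-upTo (suc J)) ⟩
    suc J * (125 * (18 * (K * K)) ^ 3)                  ∎
    where open ℕP.≤-Reasoning

module GridTuples where

  open import Data.Nat using (_*_; _^_; _≤_; _<_)
  open Counting
  open Vectors
  open Norm
  open Boxes
  open CoplanarTriples

  ∣embed∣≤ : ∀ {m} (i : Fin m) → ∣ + toℕ i ∣ ≤ m
  ∣embed∣≤ i = ℕP.<⇒≤ (Fin.toℕ<n i)

  ‖embed‖≤ : ∀ {m} (p : Grid m) → ‖ embed p ‖ ≤ m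
  ‖embed‖≤ (x , y , z) = ℕP.⊔-lub (ℕP.⊔-lub (∣embed∣≤ x) (∣embed∣≤ y)) (∣embed∣≤ z)

  ‖embed-embed‖≤ : ∀ {m} (q p : Grid m) → ‖ embed q -ᵥ embed p ‖ ≤ m
  ‖embed-embed‖≤ {m} (x , y , z) (x′ , y′ , z′) = ℕP.⊔-lub (ℕP.⊔-lub (distance x x′) (distance y y′)) (distance z z′)
    where
    distance : (i j : Fin m) → ∣ + toℕ i ℤ.- + toℕ j ∣ ≤ m
    distance i j = begin
      ∣ + toℕ i ℤ.- + toℕ j ∣   ≡⟨ cong ∣_∣ (ℤP.[+m]-[+n]≡m⊖n (toℕ i) (toℕ j)) ⟩
      ∣ toℕ i ℤ.⊖ toℕ j ∣       ≤⟨ ℤP.∣m⊝n∣≤m⊔n (toℕ i) (toℕ j) ⟩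
      toℕ i ℕ.⊔ toℕ j           ≤⟨ ℕP.⊔-lub (∣embed∣≤ i) (∣embed∣≤ j) ⟩
      m                         ∎
      where open ℕP.≤-Reasoning

  embed-injective : ∀ {m} {p q : Grid m} → embed p ≡ embed q → p ≡ q
  embed-injective {m} {x , y , z} {x′ , y′ , z′} e =
    cong₂ _,_ (from-coord (cong (coord x-axis) e)) (cong₂ _,_ (from-coord (cong (coord y-axis) e)) (from-coord (cong (coord z-axis) e)))
    where
    from-coord : ∀ {i j : Fin m} → + toℕ i ≡ + toℕ j → i ≡ j
    from-coord = Fin.toℕ-injective ∘ ℤP.+-injective

  nondegenerate-normal : ∀ {a b c} → ¬ (a ≡ 0ℤ × b ≡ 0ℤ × c ≡ 0ℤ) → (a , b , c) ≢ origin
  nondegenerate-normal nondeg refl = nondeg (refl , refl , refl)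

  coplanar-with-origin : ∀ {x y z} → Coplanar4 x y z origin → Coplanar₀ x y z
  coplanar-with-origin (plane a b c d nondeg , x∈ , y∈ , z∈ , origin∈) =
    (a , b , c) , nondegenerate-normal nondeg , orthogonal (trans x∈ d≡0) , orthogonal (trans y∈ d≡0) , orthogonal (trans z∈ d≡0)
    where
    d≡0 : d ≡ 0ℤ
    d≡0 = trans (sym origin∈) (∙-origin (a , b , c))

  coplanar-translate : ∀ {p q r s} → Coplanar4 p q r s → Coplanar₀ (q -ᵥ p) (r -ᵥ p) (s -ᵥ p)
  coplanar-translate {p} (plane a b c d nondeg , p∈ , q∈ , r∈ , s∈) =
    (a , b , c) , nondegenerate-normal nondeg , relative q∈ , relative r∈ , relative s∈
    where
    relative : ∀ {x} → (a , b , c) ∙ x ≡ d → (a , b , c) ⊥ x -ᵥ p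
    relative {x} x∈ = orthogonal (trans (∙-sub (a , b , c) x p) (trans (cong₂ ℤ._-_ x∈ p∈) (ℤP.+-inverseʳ d)))

  triple : ∀ {m} → Vec (Grid m) 3 → Point × Point × Point
  triple (p ∷ q ∷ r ∷ []) = embed p , embed q , embed r

  triple-injective : ∀ {m} {x y : Vec (Grid m) 3} → triple x ≡ triple y → x ≡ y
  triple-injective {x = _ ∷ _ ∷ _ ∷ []} {_ ∷ _ ∷ _ ∷ []} e =
    cong₂ _∷_ (embed-injective (cong proj₁ e))
      (cong₂ _∷_ (embed-injective (cong (proj₁ ∘ proj₂) e)) (cong (_∷ []) (embed-injective (cong (proj₂ ∘ proj₂) e))))

  quadruple : ∀ {m} → Vec (Grid m) 4 → Point × Point × Point × Point
  quadruple (p ∷ q ∷ r ∷ s ∷ []) = embed p , embed q -ᵥ embed p , embed r -ᵥ embed p , embed s -ᵥ embed p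

  quadruple-injective : ∀ {m} {x y : Vec (Grid m) 4} → quadruple x ≡ quadruple y → x ≡ y
  quadruple-injective {x = p ∷ q ∷ r ∷ s ∷ []} {p′ ∷ q′ ∷ r′ ∷ s′ ∷ []} e =
    cong₂ _∷_ (embed-injective p≡p′)
      (cong₂ _∷_ (relative (cong (proj₁ ∘ proj₂) e))
        (cong₂ _∷_ (relative (cong (proj₁ ∘ proj₂ ∘ proj₂) e)) (cong (_∷ []) (relative (cong (proj₂ ∘ proj₂ ∘ proj₂) e)))))
    where
    p≡p′ = cong proj₁ e
    relative : ∀ {t t′} → embed t -ᵥ embed p ≡ embed t′ -ᵥ embed p′ → t ≡ t′
    relative {t} {t′} e′ = embed-injective (-ᵥ-cancelʳ (embed t) (embed t′) (embed p) (trans e′ (cong (embed t′ -ᵥ_) (sym p≡p′))))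

  module _ {m : ℕ} (J : ℕ) (1≤m : 1 ≤ m) (2m²<2^[1+J] : 2 * (m * m) < 2 ^ suc J) where

    coplanarWithOrigin-countAtMost : CountAtMost {Vec (Grid m) 3} CoplanarWithOrigin (length (coplanarTriples m J))
    coplanarWithOrigin-countAtMost =
      countAtMost-injection triple (coplanarTriples m J) (λ _ _ → triple-injective) λ {x} → listed x
      where
      listed : ∀ x → CoplanarWithOrigin x → triple x ∈ coplanarTriples m J
      listed (p ∷ q ∷ r ∷ []) cop =
        ∈-coplanarTriples J 1≤m 2m²<2^[1+J] (‖embed‖≤ p) (‖embed‖≤ q) (‖embed‖≤ r) (coplanar-with-origin cop)

    coplanar-countAtMost : CountAtMost {Vec (Grid m) 4} Coplanar (length (box m) * length (coplanarTriples m J))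
    coplanar-countAtMost = countAtMost-mono (ℕP.≤-reflexive (length-cartesianProduct (box m) (coplanarTriples m J)))
      (countAtMost-injection quadruple (cartesianProduct (box m) (coplanarTriples m J)) (λ _ _ → quadruple-injective) λ {x} → listed x)
      where
      listed : ∀ x → Coplanar x → quadruple x ∈ cartesianProduct (box m) (coplanarTriples m J)
      listed (p ∷ q ∷ r ∷ s ∷ []) cop = ∈-cartesianProduct⁺ (∈-box⁺ (‖embed‖≤ p))
        (∈-coplanarTriples J 1≤m 2m²<2^[1+J] (‖embed-embed‖≤ q p) (‖embed-embed‖≤ r p) (‖embed-embed‖≤ s p) (coplanar-translate cop))

module Bounds where

  open import Data.Nat using (_+_; _*_; _^_; _≤_; _<_)
  open import Data.Nat.Logarithm using (⌊log₂_⌋; ⌊log₂⌋-mono-≤; ⌊log₂[2^n]⌋≡n)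
  open Counting
  open Boxes
  open CoplanarTriples

  1≤⌊log₂⌋ : ∀ {m} → 2 ≤ m → 1 ≤ ⌊log₂ m ⌋
  1≤⌊log₂⌋ 2≤m = ⌊log₂⌋-mono-≤ 2≤m

  <2^[1+⌊log₂⌋] : ∀ m → m < 2 ^ suc ⌊log₂ m ⌋
  <2^[1+⌊log₂⌋] m = ℕP.≰⇒> λ 2^[1+l]≤m →
    ℕP.<-irrefl refl (subst (_≤ ⌊log₂ m ⌋) (⌊log₂[2^n]⌋≡n (suc ⌊log₂ m ⌋)) (⌊log₂⌋-mono-≤ 2^[1+l]≤m))

  lastShell : ℕ → ℕ
  lastShell m = suc ⌊log₂ m ⌋ + suc ⌊log₂ m ⌋

  2m²<2^[1+lastShell] : ∀ m → 2 * (m * m) < 2 ^ suc (lastShell m)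
  2m²<2^[1+lastShell] m = ℕP.*-monoʳ-< 2 (subst (m * m <_) (sym (ℕP.^-distribˡ-+-* 2 (suc l) (suc l)))
    (ℕP.*-mono-< (<2^[1+⌊log₂⌋] m) (<2^[1+⌊log₂⌋] m)))
    where l = ⌊log₂ m ⌋

  C₃ : ℕ
  C₃ = 5 * 125 * 18 ^ 3

  length-coplanarTriples-≤ : ∀ {m} → 2 ≤ m → length (coplanarTriples m (lastShell m)) ≤ C₃ * m ^ 6 * ⌊log₂ m ⌋
  length-coplanarTriples-≤ {m} 2≤m = begin
    length (coplanarTriples m (lastShell m))          ≤⟨ length-coplanarTriples m (lastShell m) ⟩
    suc (suc l + suc l) * (125 * (18 * (m * m)) ^ 3)  ≤⟨ ℕP.*-monoˡ-≤ _ shells≤5l ⟩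
    5 * l * (125 * (18 * (m * m)) ^ 3)                ≡⟨ cong (λ x → 5 * l * (125 * x)) (trans (cube-* 18 (m * m)) (cong (18 ^ 3 *_) (square-cubed m))) ⟩
    5 * l * (125 * (18 ^ 3 * m ^ 6))                  ≡⟨ regroup 5 125 (18 ^ 3) (m ^ 6) l ⟩
    C₃ * m ^ 6 * l                                    ∎
    where
    open ℕP.≤-Reasoning
    l = ⌊log₂ m ⌋
    shells≤5l : suc (suc l + suc l) ≤ 5 * l
    shells≤5l = begin
      suc (suc l + suc l)   ≡⟨ count l ⟩
      3 + 2 * l             ≤⟨ ℕP.+-monoˡ-≤ (2 * l) (ℕP.*-monoʳ-≤ 3 (1≤⌊log₂⌋ 2≤m)) ⟩
      3 * l + 2 * l         ≡⟨ collect l ⟩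
      5 * l                 ∎
      where
      count : ∀ l → suc (suc l + suc l) ≡ 3 + 2 * l
      count = ℕ-solve-∀
      collect : ∀ l → 3 * l + 2 * l ≡ 5 * l
      collect = ℕ-solve-∀
    cube-* : ∀ a b → (a * b) ^ 3 ≡ a ^ 3 * b ^ 3
    cube-* a b = expand a b
      where
      expand : ∀ a b → a * b * (a * b * (a * b * 1)) ≡ a * (a * (a * 1)) * (b * (b * (b * 1)))
      expand = ℕ-solve-∀
    square-cubed : ∀ m → (m * m) ^ 3 ≡ m ^ 6
    square-cubed m = expand m
      where
      expand : ∀ m → m * m * (m * m * (m * m * 1)) ≡ m * (m * (m * (m * (m * (m * 1)))))
      expand = ℕ-solve-∀
    regroup : ∀ a b c M l → a * l * (b * (c * M)) ≡ a * b * c * M * l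
    regroup = ℕ-solve-∀

  length-box-≤ : ∀ {m} → 1 ≤ m → length (box m) ≤ 27 * m ^ 3
  length-box-≤ {m} 1≤m = begin
    length (box m)     ≡⟨ length-box m ⟩
    (1 + 2 * m) ^ 3    ≤⟨ ℕP.^-monoˡ-≤ 3 (ℕP.+-monoˡ-≤ (2 * m) 1≤m) ⟩
    (m + 2 * m) ^ 3    ≡⟨ expand m ⟩
    27 * m ^ 3         ∎
    where
    open ℕP.≤-Reasoning
    expand : ∀ m → (m + 2 * m) * ((m + 2 * m) * ((m + 2 * m) * 1)) ≡ 27 * (m * (m * (m * 1)))
    expand = ℕ-solve-∀

  length-box*length-coplanarTriples-≤ : ∀ {m} → 2 ≤ m →
    length (box m) * length (coplanarTriples m (lastShell m)) ≤ 27 * C₃ * m ^ 9 * ⌊log₂ m ⌋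
  length-box*length-coplanarTriples-≤ {m} 2≤m = begin
    length (box m) * length (coplanarTriples m (lastShell m)) ≤⟨ ℕP.*-mono-≤ (length-box-≤ (ℕP.≤-trans (ℕP.n≤1+n 1) 2≤m)) (length-coplanarTriples-≤ 2≤m) ⟩
    27 * m ^ 3 * (C₃ * m ^ 6 * ⌊log₂ m ⌋)                  ≡⟨ regroup 27 (m ^ 3) C₃ (m ^ 6) ⌊log₂ m ⌋ ⟩
    27 * C₃ * (m ^ 3 * m ^ 6) * ⌊log₂ m ⌋                  ≡⟨ cong (λ x → 27 * C₃ * x * ⌊log₂ m ⌋) (ℕP.^-distribˡ-+-* m 3 6) ⟨
    27 * C₃ * m ^ 9 * ⌊log₂ m ⌋                            ∎
    where
    open ℕP.≤-Reasoning
    regroup : ∀ a x c M l → a * x * (c * M * l) ≡ a * c * (x * M) * l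
    regroup = ℕ-solve-∀

open import Data.Nat using (_≤_; _*_; _^_)
open import Data.Nat.Logarithm using (⌊log₂_⌋)
open Counting using (countAtMost-mono)
open Bounds
open GridTuples using (coplanarWithOrigin-countAtMost; coplanar-countAtMost)

proposition2p3 : ∃[ C ] ∃[ M ] ∀ (m : ℕ) → 1 ≤ m → M ≤ m →
    CountAtMost {Vec (Grid m) 3} CoplanarWithOrigin (C * m ^ 6 * ⌊log₂ m ⌋)
    × CountAtMost {Vec (Grid m) 4} Coplanar (C * m ^ 9 * ⌊log₂ m ⌋)
proposition2p3 = 27 * C₃ , 2 , λ m 1≤m 2≤m →
    countAtMost-mono (ℕP.≤-trans (length-coplanarTriples-≤ 2≤m) (C₃≤27C₃ m))
      (coplanarWithOrigin-countAtMost (lastShell m) 1≤m (2m²<2^[1+lastShell] m))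
  , countAtMost-mono (length-box*length-coplanarTriples-≤ 2≤m) (coplanar-countAtMost (lastShell m) 1≤m (2m²<2^[1+lastShell] m))
  where
  C₃≤27C₃ : ∀ m → C₃ * m ^ 6 * ⌊log₂ m ⌋ ≤ 27 * C₃ * m ^ 6 * ⌊log₂ m ⌋
  C₃≤27C₃ m = ℕP.*-monoˡ-≤ ⌊log₂ m ⌋ (ℕP.*-monoˡ-≤ (m ^ 6) (ℕP.m≤n*m C₃ 27))
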